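{- Consider walks on $\mathbb Z^2$ starting at $(0,0)$ with steps in $\{(1,0),(-1,0),(0,1),(0,-1)\}$ that never visit a point of negative ordinate. Let $S(x,y;t)$ be the generating function of such walks that moreover avoid the half-line $\{(k,0):k\le0\}$ after their start, $S_0(x;t)$ the generating function of those among them ending on the $x$-axis, and $L(t)$ the generating function of such walks that end at $(0,0)$ and never visit $\{(k,0):k<0\}$. Let $$M(x;t)=\frac{1-t(x+\bar x)-\sqrt{(1-t(x+\bar x+2))(1-t(x+\bar x-2))}}{2t^2}$$ be the generating function of bicolored Motzkin walks. Then $$S_0(\bar x;t)L(t)S_0(x;t)=M(x;t),\qquad S(x,y;t)=\frac{S_0(x;t)}{1-tyM(x;t)}.$$
   Context: $\bar x=1/x$. A walk is a sequence $(w_0,\dots,w_n)$ with $w_0=(0,0)$ and each $w_i-w_{i-1}$ a step; $n$ is its length. A bicolored Motzkin walk is such a walk ending on the $x$-axis and never visiting a point of negative ordinate. The generating function of a set of walks is $\sum_nt^n\sum_{i,j}a_{i,j}(n)x^iy^j$ with $a_{i,j}(n)$ the number of its walks of length $n$ ending at $(i,j)$ ($y$ omitted for walks ending on the $x$-axis, only $t$ for $L$). $S_0(\bar x;t)$ is $S_0(x;t)$ with $x$ replaced by $1/x$. -}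

module Defs where

open import Data.Bool using (Bool; true; false; _∧_; not)
open import Data.Nat using (ℕ; zero; suc; _∸_)
open import Data.Integer as ℤ using (ℤ; +_; -_; _≤?_; _<?_)
import Data.Integer.Properties as ℤP
open import Data.Product using (_×_; _,_; proj₁; proj₂)
open import Data.Product.Properties using (≡-dec)
open import Data.List using (List; []; _∷_; [_]; map; concatMap; filterᵇ; filter; length; upTo; foldl)
open import Relation.Nullary using (does)
open import Relation.Binary.PropositionalEquality using (_≡_)

data Step : Set where
  E W N S : Step

Point : Set
Point = ℤ × ℤ

origin : Point
origin = (+ 0 , + 0)

move : Step → Point → Point
move E (i , j) = (i ℤ.+ + 1 , j)
move W (i , j) = (i ℤ.- + 1 , j)
move N (i , j) = (i , j ℤ.+ + 1)
move S (i , j) = (i , j ℤ.- + 1)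

-- points w_1, ..., w_n visited after the start p = w_0
visits : Point → List Step → List Point
visits p [] = []
visits p (s ∷ ss) = move s p ∷ visits (move s p) ss

endpoint : List Step → Point
endpoint = foldl (λ p s → move s p) origin

words : ℕ → List (List Step)
words zero = [ [] ]
words (suc n) = concatMap (λ s → map (s ∷_) (words n)) (E ∷ W ∷ N ∷ S ∷ [])

allB : {A : Set} → (A → Bool) → List A → Bool
allB p [] = true
allB p (a ∷ as) = p a ∧ allB p as

infix 4 _==_
_==_ : ℤ → ℤ → Bool
a == b = does (a ℤP.≟ b)

nonnegOrd : Point → Bool
nonnegOrd (i , j) = does (+ 0 ≤? j)

onNonposAxis : Point → Bool
onNonposAxis (i , j) = (j == + 0) ∧ does (i ≤? + 0)

onNegAxis : Point → Bool
onNegAxis (i , j) = (j == + 0) ∧ does (i <? + 0)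

upper : List Step → Bool
upper w = allB nonnegOrd (visits origin w)

isS : List Step → Bool
isS w = upper w ∧ allB (λ p → not (onNonposAxis p)) (visits origin w)

isS0 : List Step → Bool
isS0 w = isS w ∧ (proj₂ (endpoint w) == + 0)

isL : List Step → Bool
isL w = upper w ∧ allB (λ p → not (onNegAxis p)) (visits origin w)
          ∧ (proj₁ (endpoint w) == + 0) ∧ (proj₂ (endpoint w) == + 0)

-- bicolored Motzkin walks: upper, ending on the x-axis
isM : List Step → Bool
isM w = upper w ∧ (proj₂ (endpoint w) == + 0)

-- A (formal) generating function in t, x, y with coefficients in ℕ,
-- represented by: for each n, the multiset (list) of monomials x^i y^j
-- (as exponent pairs (i , j)) of the coefficient of t^n.
Series : Set
Series = ℕ → List Point

coeff : Series → ℕ → Point → ℕ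
coeff A n p = length (filter (λ q → ≡-dec ℤP._≟_ ℤP._≟_ q p) (A n))

_≈_ : Series → Series → Set
A ≈ B = ∀ n p → coeff A n p ≡ coeff B n p

-- generating function of a class of walks: weight t^length x^i y^j
gf : (List Step → Bool) → Series
gf P n = map endpoint (filterᵇ P (words n))

S-gf S0-gf L-gf M-gf : Series
S-gf = gf isS
S0-gf = gf isS0
-- walks of L all end at (0,0), so L only involves t
L-gf = gf isL
M-gf = gf isM

-- substitution x ↦ 1/x
xbar : Series → Series
xbar A n = map (λ p → (ℤ.- proj₁ p , proj₂ p)) (A n)

addP : Point → Point → Point
addP (a , b) (c , d) = (a ℤ.+ c , b ℤ.+ d)

_⊛_ : Series → Series → Series
(A ⊛ B) n = concatMap (λ k → concatMap (λ a → map (addP a) (B (n ∸ k))) (A k)) (upTo (suc n))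

one : Series
one zero = [ origin ]
one (suc n) = []

tyM : Series
tyM zero = []
tyM (suc n) = map (addP (+ 0 , + 1)) (M-gf n)

powTyM : ℕ → Series
powTyM zero = one
powTyM (suc k) = tyM ⊛ powTyM k

-- 1 / (1 - t y M) = Σ_k (t y M)^k ; (t y M)^k has no t^n term for k > n
invOneMinusTyM : Series
invOneMinusTyM n = concatMap (λ k → powTyM k n) (upTo (suc n))

-- Both identities are proved coefficientwise by comparing, for every weight h on end points, the
-- sums of h over the two multisets of monomials; they then reduce to unique factorisations of walks.
--
-- A bicolored Motzkin walk w factors uniquely as u v z, where u ends at the first and v at the last
-- visit of w to the leftmost point it visits on the x-axis: u read backwards is an S₀-walk (reversal
-- turns x into x̄), v is an L-walk based at that point, and z is an S₀-walk.  An S-walk splits at its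
-- last visit to the x-axis into an S₀-walk followed by a walk Q staying strictly above the axis.
-- Such a Q-walk is empty or a north step followed by a walk that splits at its last visit to its
-- starting level into a bicolored Motzkin walk and a Q-walk; so Q = 1 + tyMQ, whose unique
-- solution is 1/(1 - tyM).

module Submission where

open import Defs
open import Data.Bool using (Bool; true; false; T; _∧_; not)
open import Data.Bool.Properties using (T-∧)
open import Data.Empty using (⊥-elim)
open import Data.Integer as ℤ using (ℤ; +_; -_; _≤?_; _<?_)
import Data.Integer.Properties as ℤP
open import Data.List
  using (List; []; _∷_; [_]; _++_; _∷ʳ_; map; concatMap; upTo; applyUpTo; filter; filterᵇ; length; take; drop; foldl; reverse)
import Data.List.Properties as List
open import Data.List.Relation.Unary.All as All using (All; []; _∷_)
import Data.List.Relation.Unary.All.Properties as All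
open import Data.List.Relation.Binary.Permutation.Propositional using (↭-sym)
open import Data.List.Relation.Binary.Permutation.Propositional.Properties using (All-resp-↭; ↭-reverse)
open import Data.Nat using (ℕ; zero; suc; _+_; _∸_; _≤_; _<_; _≟_; z≤n; s≤s)
import Data.Nat.Properties as ℕP
open import Data.Product using (_×_; _,_; proj₁; proj₂; ∃; ∃-syntax)
open import Data.Product.Function.NonDependent.Propositional using (_×-⇔_)
open import Data.Product.Properties using (≡-dec)
open import Data.Sum using (inj₁; inj₂; [_,_]′)
open import Function using (_∘_; const)
open import Function.Bundles using (_⇔_; mk⇔; Equivalence)
import Function.Properties.Equivalence as ⇔
open import Function.Related.Propositional using (module EquationalReasoning)
open import Relation.Binary.Definitions using (tri<; tri≈; tri>)
open import Relation.Binary.PropositionalEquality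
  using (_≡_; _≢_; refl; sym; trans; cong; cong₂; subst; module ≡-Reasoning)
open import Relation.Nullary using (¬_; Dec; yes; no; does)
open import Relation.Nullary.Decidable using (T?)
open import Relation.Unary using (Pred; Decidable)
open import Algebra.Properties.CommutativeSemigroup ℕP.+-commutativeSemigroup using (interchange; x∙yz≈y∙xz)
import Algebra.Properties.CommutativeSemigroup ℤP.+-commutativeSemigroup as ℤ+

-- Iverson brackets and finite sums

infixl 5 _when_

_when_ : ℕ → Bool → ℕ
x when true  = x
x when false = 0

when-∧ : ∀ x a b → x when (a ∧ b) ≡ (x when b) when a
when-∧ x true  b = refl
when-∧ x false b = refl

when-T : ∀ {b} x → T b → x when b ≡ x
when-T {true} x _ = refl

when-¬T : ∀ {b} x → ¬ T b → x when b ≡ 0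
when-¬T {true}  x ¬b = ⊥-elim (¬b _)
when-¬T {false} x ¬b = refl

when-cong : ∀ b {x y} → (T b → x ≡ y) → x when b ≡ y when b
when-cong true  x≡y = x≡y _
when-cong false x≡y = refl

∑ : {A : Set} → List A → (A → ℕ) → ℕ
∑ []       f = 0
∑ (x ∷ xs) f = f x + ∑ xs f

syntax ∑ xs (λ x → e) = ∑[ x ∈ xs ] e

module _ {A : Set} where

  ∑-cong : ∀ (xs : List A) {f g : A → ℕ} → (∀ x → f x ≡ g x) → ∑ xs f ≡ ∑ xs g
  ∑-cong []       f≡g = refl
  ∑-cong (x ∷ xs) f≡g = cong₂ _+_ (f≡g x) (∑-cong xs f≡g)

  ∑-zero : ∀ (xs : List A) {f : A → ℕ} → (∀ x → f x ≡ 0) → ∑ xs f ≡ 0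
  ∑-zero []       f≡0 = refl
  ∑-zero (x ∷ xs) f≡0 = cong₂ _+_ (f≡0 x) (∑-zero xs f≡0)

  ∑-++ : ∀ (xs ys : List A) (f : A → ℕ) → ∑ (xs ++ ys) f ≡ ∑ xs f + ∑ ys f
  ∑-++ []       ys f = refl
  ∑-++ (x ∷ xs) ys f = trans (cong (_+_ (f x)) (∑-++ xs ys f)) (sym (ℕP.+-assoc (f x) _ _))

  ∑-+ : ∀ (xs : List A) (f g : A → ℕ) → ∑[ x ∈ xs ] (f x + g x) ≡ ∑ xs f + ∑ xs g
  ∑-+ []       f g = refl
  ∑-+ (x ∷ xs) f g = trans (cong (_+_ (f x + g x)) (∑-+ xs f g)) (interchange (f x) (g x) _ _)

  ∑-when : ∀ (xs : List A) (f : A → ℕ) b → ∑[ x ∈ xs ] (f x when b) ≡ ∑ xs f when b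
  ∑-when xs f true  = refl
  ∑-when xs f false = ∑-zero xs (λ _ → refl)

  ∑-filter : ∀ {p} {P : Pred A p} (P? : ∀ x → Dec (P x)) (xs : List A) (f : A → ℕ) →
             ∑ (filter P? xs) f ≡ ∑[ x ∈ xs ] (f x when does (P? x))
  ∑-filter P? []       f = refl
  ∑-filter P? (x ∷ xs) f with does (P? x)
  ... | true  = cong (_+_ (f x)) (∑-filter P? xs f)
  ... | false = ∑-filter P? xs f

  length-∑ : ∀ (xs : List A) → length xs ≡ ∑[ x ∈ xs ] 1
  length-∑ []       = refl
  length-∑ (x ∷ xs) = cong suc (length-∑ xs)

module _ {A B : Set} where

  ∑-map : ∀ (g : A → B) xs (f : B → ℕ) → ∑ (map g xs) f ≡ ∑[ x ∈ xs ] f (g x)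
  ∑-map g []       f = refl
  ∑-map g (x ∷ xs) f = cong (_+_ (f (g x))) (∑-map g xs f)

  ∑-concatMap : ∀ (g : A → List B) xs (f : B → ℕ) → ∑ (concatMap g xs) f ≡ ∑[ x ∈ xs ] ∑ (g x) f
  ∑-concatMap g []       f = refl
  ∑-concatMap g (x ∷ xs) f = trans (∑-++ (g x) _ f) (cong (_+_ (∑ (g x) f)) (∑-concatMap g xs f))

  ∑-swap : ∀ (xs : List A) (ys : List B) (f : A → B → ℕ) →
           ∑[ x ∈ xs ] ∑[ y ∈ ys ] f x y ≡ ∑[ y ∈ ys ] ∑[ x ∈ xs ] f x y
  ∑-swap []       ys f = sym (∑-zero ys (λ _ → refl))
  ∑-swap (x ∷ xs) ys f = trans (cong (_+_ (∑ ys (f x))) (∑-swap xs ys f)) (sym (∑-+ ys (f x) _))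

∑< : ℕ → (ℕ → ℕ) → ℕ
∑< zero    g = 0
∑< (suc n) g = ∑< n g + g n

syntax ∑< n (λ k → e) = ∑[ k < n ] e

∑-upTo : ∀ n (g : ℕ → ℕ) → ∑ (upTo n) g ≡ ∑< n g
∑-upTo zero    g = refl
∑-upTo (suc n) g = begin
  ∑ (upTo (suc n)) g        ≡⟨ cong (λ ks → ∑ ks g) (sym (List.upTo-∷ʳ n)) ⟩
  ∑ (upTo n ++ [ n ]) g     ≡⟨ ∑-++ (upTo n) [ n ] g ⟩
  ∑ (upTo n) g + (g n + 0)  ≡⟨ cong₂ _+_ (∑-upTo n g) (ℕP.+-identityʳ (g n)) ⟩
  ∑< n g + g n              ∎
  where open ≡-Reasoning

∑<-cong : ∀ n {f g : ℕ → ℕ} → (∀ k → k < n → f k ≡ g k) → ∑< n f ≡ ∑< n g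
∑<-cong zero    f≡g = refl
∑<-cong (suc n) f≡g =
  cong₂ _+_ (∑<-cong n (λ k k<n → f≡g k (ℕP.m<n⇒m<1+n k<n))) (f≡g n ℕP.≤-refl)

∑<-zero : ∀ n {g : ℕ → ℕ} → (∀ k → k < n → g k ≡ 0) → ∑< n g ≡ 0
∑<-zero zero    g≡0 = refl
∑<-zero (suc n) g≡0 =
  cong₂ _+_ (∑<-zero n (λ k k<n → g≡0 k (ℕP.m<n⇒m<1+n k<n))) (g≡0 n ℕP.≤-refl)

∑<-single : ∀ n {g : ℕ → ℕ} k₀ → k₀ < n → (∀ k → k < n → k ≢ k₀ → g k ≡ 0) →
            ∑< n g ≡ g k₀
∑<-single (suc n) {g} k₀ k₀<1+n g≡0 with k₀ ≟ n
... | yes refl = cong (_+ g n) (∑<-zero n (λ k k<n → g≡0 k (ℕP.m<n⇒m<1+n k<n) (ℕP.<⇒≢ k<n)))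
... | no k₀≢n = trans (cong₂ _+_ (∑<-single n k₀ k₀<n (λ k k<n → g≡0 k (ℕP.m<n⇒m<1+n k<n)))
                                 (g≡0 n ℕP.≤-refl (k₀≢n ∘ sym)))
                      (ℕP.+-identityʳ _)
  where k₀<n = ℕP.≤∧≢⇒< (ℕP.≤-pred k₀<1+n) k₀≢n

∑<-∑ : ∀ {A : Set} n (xs : List A) (f : ℕ → A → ℕ) →
       ∑[ k < n ] ∑ xs (f k) ≡ ∑[ x ∈ xs ] ∑[ k < n ] f k x
∑<-∑ n xs f = begin
  ∑[ k < n ] ∑ xs (f k)            ≡⟨ sym (∑-upTo n _) ⟩
  ∑[ k ∈ upTo n ] ∑ xs (f k)       ≡⟨ ∑-swap (upTo n) xs f ⟩
  ∑[ x ∈ xs ] ∑[ k ∈ upTo n ] f k x ≡⟨ ∑-cong xs (λ x → ∑-upTo n _) ⟩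
  ∑[ x ∈ xs ] ∑[ k < n ] f k x     ∎
  where open ≡-Reasoning

∑<-swap : ∀ m n (f : ℕ → ℕ → ℕ) → ∑[ j < m ] ∑[ k < n ] f j k ≡ ∑[ k < n ] ∑[ j < m ] f j k
∑<-swap m n f = begin
  ∑[ j < m ] ∑[ k < n ] f j k      ≡⟨ ∑<-cong m (λ j _ → sym (∑-upTo n (f j))) ⟩
  ∑[ j < m ] ∑ (upTo n) (f j)      ≡⟨ ∑<-∑ m (upTo n) f ⟩
  ∑[ k ∈ upTo n ] ∑[ j < m ] f j k ≡⟨ ∑-upTo n _ ⟩
  ∑[ k < n ] ∑[ j < m ] f j k      ∎
  where open ≡-Reasoning

∑<-suc : ∀ n (g : ℕ → ℕ) → ∑< (suc n) g ≡ g 0 + ∑[ k < n ] g (suc k)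
∑<-suc zero    g = ℕP.+-comm 0 (g 0)
∑<-suc (suc n) g = trans (cong (_+ g (suc n)) (∑<-suc n g)) (ℕP.+-assoc (g 0) _ _)

∑<-truncate : ∀ {m} n (g : ℕ → ℕ) → m ≤ n → (∀ k → m ≤ k → k < n → g k ≡ 0) →
              ∑< n g ≡ ∑< m g
∑<-truncate {m} n g m≤n g≡0 with ℕP.m≤n⇒m<n∨m≡n m≤n
... | inj₂ refl = refl
∑<-truncate {m} (suc n) g m≤n g≡0 | inj₁ m<1+n =
  trans (cong₂ _+_ (∑<-truncate n g m≤n′ (λ k m≤k k<n → g≡0 k m≤k (ℕP.m<n⇒m<1+n k<n)))
                   (g≡0 n m≤n′ ℕP.≤-refl))
        (ℕP.+-identityʳ _)
  where m≤n′ = ℕP.≤-pred m<1+n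

when-≡-∑< : ∀ n (c : ℕ → Bool) b x →
            (∀ k → k ≤ n → T (c k) → T b) →
            (T b → ∃[ k ] k ≤ n × T (c k)) →
            (∀ {k k′} → k ≤ n → k′ ≤ n → T (c k) → T (c k′) → k ≡ k′) →
            x when b ≡ ∑[ k < suc n ] (x when c k)
when-≡-∑< n c false x sound complete unique =
  sym (∑<-zero (suc n) (λ k k≤n → when-¬T x (sound k (ℕP.≤-pred k≤n))))
when-≡-∑< n c true x sound complete unique with complete _
... | k₀ , k₀≤n , ck₀ = sym (trans (∑<-single (suc n) k₀ (s≤s k₀≤n) others) (when-T x ck₀))
  where
  others : ∀ k → k < suc n → k ≢ k₀ → x when c k ≡ 0
  others k k<1+n k≢k₀ = when-¬T x (λ ck → k≢k₀ (unique (ℕP.≤-pred k<1+n) k₀≤n ck ck₀))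

when-≡-∑<∑< : ∀ n (c : ℕ → ℕ → Bool) b x →
              (∀ i k → i ≤ k → k ≤ n → T (c i k) → T b) →
              (T b → ∃[ i ] ∃[ k ] i ≤ k × k ≤ n × T (c i k)) →
              (∀ {i k i′ k′} → i ≤ k → k ≤ n → i′ ≤ k′ → k′ ≤ n →
                T (c i k) → T (c i′ k′) → i ≡ i′ × k ≡ k′) →
              x when b ≡ ∑[ k < suc n ] ∑[ i < suc k ] (x when c i k)
when-≡-∑<∑< n c false x sound complete unique =
  sym (∑<-zero (suc n) λ k k≤n → ∑<-zero (suc k) λ i i≤k →
         when-¬T x (sound i k (ℕP.≤-pred i≤k) (ℕP.≤-pred k≤n)))
when-≡-∑<∑< n c true x sound complete unique with complete _
... | i₀ , k₀ , i₀≤k₀ , k₀≤n , c₀ =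
  sym (trans (∑<-single (suc n) k₀ (s≤s k₀≤n) otherColumns)
             (trans (∑<-single (suc k₀) i₀ (s≤s i₀≤k₀) otherRows) (when-T x c₀)))
  where
  otherColumns : ∀ k → k < suc n → k ≢ k₀ → ∑[ i < suc k ] (x when c i k) ≡ 0
  otherColumns k k<1+n k≢k₀ = ∑<-zero (suc k) λ i i<1+k → when-¬T x λ c₁ →
    k≢k₀ (proj₂ (unique (ℕP.≤-pred i<1+k) (ℕP.≤-pred k<1+n) i₀≤k₀ k₀≤n c₁ c₀))
  otherRows : ∀ i → i < suc k₀ → i ≢ i₀ → x when c i k₀ ≡ 0
  otherRows i i<1+k₀ i≢i₀ = when-¬T x λ c₁ →
    i≢i₀ (proj₁ (unique (ℕP.≤-pred i<1+k₀) k₀≤n i₀≤k₀ k₀≤n c₁ c₀))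

-- Series compared through weighted sums

infix 4 _≋_

record _≋_ (A B : Series) : Set where
  field
    ∑-≡ : ∀ n (h : Point → ℕ) → ∑ (A n) h ≡ ∑ (B n) h

open _≋_ public

≋-refl : ∀ {A} → A ≋ A
≋-refl .∑-≡ n h = refl

≋-sym : ∀ {A B} → A ≋ B → B ≋ A
≋-sym A≋B .∑-≡ n h = sym (A≋B .∑-≡ n h)

≋-trans : ∀ {A B C} → A ≋ B → B ≋ C → A ≋ C
≋-trans A≋B B≋C .∑-≡ n h = trans (A≋B .∑-≡ n h) (B≋C .∑-≡ n h)

≋⇒≈ : ∀ {A B} → A ≋ B → A ≈ B
≋⇒≈ {A} {B} A≋B n p = begin
  coeff A n p                             ≡⟨ coeff-∑ A ⟩
  ∑[ q ∈ A n ] (1 when does (q ≟ᵖ p))     ≡⟨ A≋B .∑-≡ n _ ⟩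
  ∑[ q ∈ B n ] (1 when does (q ≟ᵖ p))     ≡⟨ coeff-∑ B ⟨
  coeff B n p                             ∎
  where
  open ≡-Reasoning
  _≟ᵖ_ = ≡-dec ℤP._≟_ ℤP._≟_
  coeff-∑ : ∀ C → coeff C n p ≡ ∑[ q ∈ C n ] (1 when does (q ≟ᵖ p))
  coeff-∑ C = trans (length-∑ (filter (_≟ᵖ p) (C n))) (∑-filter (_≟ᵖ p) (C n) _)

∑-gf : ∀ P n (h : Point → ℕ) → ∑ (gf P n) h ≡ ∑[ w ∈ words n ] (h (endpoint w) when P w)
∑-gf P n h = trans (∑-map endpoint (filterᵇ P (words n)) h) (∑-filter (T? ∘ P) (words n) (h ∘ endpoint))

∑-⊛ : ∀ A B n (h : Point → ℕ) →
      ∑ ((A ⊛ B) n) h ≡ ∑[ k < suc n ] ∑[ a ∈ A k ] ∑[ b ∈ B (n ∸ k) ] h (addP a b)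
∑-⊛ A B n h = begin
  ∑ ((A ⊛ B) n) h
    ≡⟨ ∑-concatMap (λ k → concatMap (λ a → map (addP a) (B (n ∸ k))) (A k)) (upTo (suc n)) h ⟩
  ∑[ k ∈ upTo (suc n) ] ∑ (concatMap (λ a → map (addP a) (B (n ∸ k))) (A k)) h
    ≡⟨ ∑-cong (upTo (suc n)) (λ k → trans (∑-concatMap (λ a → map (addP a) (B (n ∸ k))) (A k) h)
                                          (∑-cong (A k) (λ a → ∑-map (addP a) (B (n ∸ k)) h))) ⟩
  ∑[ k ∈ upTo (suc n) ] ∑[ a ∈ A k ] ∑[ b ∈ B (n ∸ k) ] h (addP a b)
    ≡⟨ ∑-upTo (suc n) _ ⟩
  ∑[ k < suc n ] ∑[ a ∈ A k ] ∑[ b ∈ B (n ∸ k) ] h (addP a b)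
    ∎
  where open ≡-Reasoning

⊛-cong-≤ : ∀ A {B C} n → (∀ m → m ≤ n → ∀ h → ∑ (B m) h ≡ ∑ (C m) h) →
           ∀ h → ∑ ((A ⊛ B) n) h ≡ ∑ ((A ⊛ C) n) h
⊛-cong-≤ A {B} {C} n B≋C h = begin
  ∑ ((A ⊛ B) n) h                                             ≡⟨ ∑-⊛ A B n h ⟩
  ∑[ k < suc n ] ∑[ a ∈ A k ] ∑[ b ∈ B (n ∸ k) ] h (addP a b) ≡⟨ ∑<-cong (suc n) same ⟩
  ∑[ k < suc n ] ∑[ a ∈ A k ] ∑[ c ∈ C (n ∸ k) ] h (addP a c) ≡⟨ ∑-⊛ A C n h ⟨
  ∑ ((A ⊛ C) n) h                                             ∎
  where
  open ≡-Reasoning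
  same : ∀ k → k < suc n → ∑[ a ∈ A k ] ∑[ b ∈ B (n ∸ k) ] h (addP a b)
                         ≡ ∑[ a ∈ A k ] ∑[ c ∈ C (n ∸ k) ] h (addP a c)
  same k _ = ∑-cong (A k) (λ a → B≋C (n ∸ k) (ℕP.m∸n≤m n k) (h ∘ addP a))

⊛-cong : ∀ {A A′ B B′} → A ≋ A′ → B ≋ B′ → A ⊛ B ≋ A′ ⊛ B′
⊛-cong {A} {A′} {B} {B′} A≋A′ B≋B′ .∑-≡ n h = begin
  ∑ ((A ⊛ B) n) h
    ≡⟨ ⊛-cong-≤ A {B} {B′} n (λ m _ → B≋B′ .∑-≡ m) h ⟩
  ∑ ((A ⊛ B′) n) h
    ≡⟨ ∑-⊛ A B′ n h ⟩
  ∑[ k < suc n ] ∑[ a ∈ A k ] ∑[ b ∈ B′ (n ∸ k) ] h (addP a b)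
    ≡⟨ ∑<-cong (suc n) (λ k _ → A≋A′ .∑-≡ k _) ⟩
  ∑[ k < suc n ] ∑[ a ∈ A′ k ] ∑[ b ∈ B′ (n ∸ k) ] h (addP a b)
    ≡⟨ ∑-⊛ A′ B′ n h ⟨
  ∑ ((A′ ⊛ B′) n) h
    ∎
  where open ≡-Reasoning

steps : List Step
steps = E ∷ W ∷ N ∷ S ∷ []

∑-words-suc : ∀ n (F : List Step → ℕ) →
              ∑ (words (suc n)) F ≡ ∑[ s ∈ steps ] ∑[ w ∈ words n ] F (s ∷ w)
∑-words-suc n F = trans (∑-concatMap (λ s → map (s ∷_) (words n)) steps F)
                        (∑-cong steps (λ s → ∑-map (s ∷_) (words n) F))

∑-words-cong : ∀ n {F G : List Step → ℕ} → (∀ w → length w ≡ n → F w ≡ G w) →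
               ∑ (words n) F ≡ ∑ (words n) G
∑-words-cong zero    F≡G = cong (_+ 0) (F≡G [] refl)
∑-words-cong (suc n) {F} {G} F≡G = begin
  ∑ (words (suc n)) F
    ≡⟨ ∑-words-suc n F ⟩
  ∑[ s ∈ steps ] ∑[ w ∈ words n ] F (s ∷ w)
    ≡⟨ ∑-cong steps (λ s → ∑-words-cong n (λ w ∣w∣≡n → F≡G (s ∷ w) (cong suc ∣w∣≡n))) ⟩
  ∑[ s ∈ steps ] ∑[ w ∈ words n ] G (s ∷ w)
    ≡⟨ ∑-words-suc n G ⟨
  ∑ (words (suc n)) G
    ∎
  where open ≡-Reasoning

∑-words-+ : ∀ a b (F : List Step → ℕ) →
            ∑ (words (a + b)) F ≡ ∑[ u ∈ words a ] ∑[ v ∈ words b ] F (u ++ v)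
∑-words-+ zero    b F = sym (ℕP.+-identityʳ _)
∑-words-+ (suc a) b F = begin
  ∑ (words (suc a + b)) F
    ≡⟨ ∑-words-suc (a + b) F ⟩
  ∑[ s ∈ steps ] ∑[ w ∈ words (a + b) ] F (s ∷ w)
    ≡⟨ ∑-cong steps (λ s → ∑-words-+ a b (F ∘ (s ∷_))) ⟩
  ∑[ s ∈ steps ] ∑[ u ∈ words a ] ∑[ v ∈ words b ] F (s ∷ u ++ v)
    ≡⟨ ∑-words-suc a _ ⟨
  ∑[ u ∈ words (suc a) ] ∑[ v ∈ words b ] F (u ++ v)
    ∎
  where open ≡-Reasoning

∑-words-split : ∀ {k n} (F : List Step → ℕ) → k ≤ n →
                ∑ (words n) F ≡ ∑[ u ∈ words k ] ∑[ v ∈ words (n ∸ k) ] F (u ++ v)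
∑-words-split {k} {n} F k≤n =
  trans (cong (λ m → ∑ (words m) F) (sym (ℕP.m+[n∸m]≡n k≤n))) (∑-words-+ k (n ∸ k) F)

-- Walk geometry

endFrom : Point → List Step → Point
endFrom = foldl (λ p s → move s p)

endFrom-++ : ∀ p u v → endFrom p (u ++ v) ≡ endFrom (endFrom p u) v
endFrom-++ = List.foldl-++ (λ p s → move s p)

visits-++ : ∀ p u v → visits p (u ++ v) ≡ visits p u ++ visits (endFrom p u) v
visits-++ p []      v = refl
visits-++ p (s ∷ u) v = cong (move s p ∷_) (visits-++ (move s p) u v)

visits-applyUpTo : ∀ p u → visits p u ≡ applyUpTo (λ t → endFrom p (take (suc t) u)) (length u)
visits-applyUpTo p []      = refl
visits-applyUpTo p (s ∷ u) = cong (move s p ∷_) (visits-applyUpTo (move s p) u)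

addP-assoc : ∀ a b c → addP (addP a b) c ≡ addP a (addP b c)
addP-assoc (a , b) (c , d) (e , f) = cong₂ _,_ (ℤP.+-assoc a c e) (ℤP.+-assoc b d f)

infixl 6 _⊖_

_⊖_ : Point → Point → Point
(x , y) ⊖ (a , b) = (x ℤ.- a , y ℤ.- b)

move-⊖ : ∀ s q b → move s q ⊖ b ≡ move s (q ⊖ b)
move-⊖ E (x , y) (a , b) = cong (_, y ℤ.- b) (ℤ+.xy∙z≈xz∙y x (+ 1) (- a))
move-⊖ W (x , y) (a , b) = cong (_, y ℤ.- b) (ℤ+.xy∙z≈xz∙y x (- + 1) (- a))
move-⊖ N (x , y) (a , b) = cong (x ℤ.- a ,_) (ℤ+.xy∙z≈xz∙y y (+ 1) (- b))
move-⊖ S (x , y) (a , b) = cong (x ℤ.- a ,_) (ℤ+.xy∙z≈xz∙y y (- + 1) (- b))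

⊖-self : ∀ b → b ⊖ b ≡ origin
⊖-self (a , b) = cong₂ _,_ (ℤP.+-inverseʳ a) (ℤP.+-inverseʳ b)

endFrom-⊖ : ∀ p b u → endFrom p u ⊖ b ≡ endFrom (p ⊖ b) u
endFrom-⊖ p b []      = refl
endFrom-⊖ p b (s ∷ u) = trans (endFrom-⊖ (move s p) b u) (cong (λ q → endFrom q u) (move-⊖ s p b))

visits-⊖ : ∀ p b u → map (_⊖ b) (visits p u) ≡ visits (p ⊖ b) u
visits-⊖ p b []      = refl
visits-⊖ p b (s ∷ u) =
  cong₂ _∷_ (move-⊖ s p b) (trans (visits-⊖ (move s p) b u) (cong (λ q → visits q u) (move-⊖ s p b)))

endpoint-relative : ∀ b u → endpoint u ≡ endFrom b u ⊖ b
endpoint-relative b u = trans (cong (λ q → endFrom q u) (sym (⊖-self b))) (sym (endFrom-⊖ b b u))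

visits-relative : ∀ b u → visits origin u ≡ map (_⊖ b) (visits b u)
visits-relative b u = trans (cong (λ q → visits q u) (sym (⊖-self b))) (sym (visits-⊖ b b u))

addP-⊖ : ∀ b q → addP b (q ⊖ b) ≡ q
addP-⊖ (a , b) (x , y) = cong₂ _,_ (cancel a x) (cancel b y)
  where
  cancel : ∀ a x → a ℤ.+ (x ℤ.- a) ≡ x
  cancel a x =
    trans (ℤ+.x∙yz≈y∙xz a x (- a)) (trans (cong (ℤ._+_ x) (ℤP.+-inverseʳ a)) (ℤP.+-identityʳ x))

endpoint-++ : ∀ u v → endpoint (u ++ v) ≡ addP (endpoint u) (endpoint v)
endpoint-++ u v = begin
  endpoint (u ++ v)
    ≡⟨ addP-⊖ (endpoint u) _ ⟨
  addP (endpoint u) (endpoint (u ++ v) ⊖ endpoint u)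
    ≡⟨ cong (λ q → addP (endpoint u) (q ⊖ endpoint u)) (endFrom-++ origin u v) ⟩
  addP (endpoint u) (endFrom (endpoint u) v ⊖ endpoint u)
    ≡⟨ cong (addP (endpoint u)) (endpoint-relative (endpoint u) v) ⟨
  addP (endpoint u) (endpoint v)
    ∎
  where open ≡-Reasoning

opposite : Step → Step
opposite E = W
opposite W = E
opposite N = S
opposite S = N

reverseWalk : List Step → List Step
reverseWalk []      = []
reverseWalk (s ∷ u) = reverseWalk u ++ [ opposite s ]

move-opposite : ∀ s p → move (opposite s) (move s p) ≡ p
move-opposite E (x , y) = cong (_, y) (trans (ℤP.+-assoc x (+ 1) (- + 1)) (ℤP.+-identityʳ x))
move-opposite W (x , y) = cong (_, y) (trans (ℤP.+-assoc x (- + 1) (+ 1)) (ℤP.+-identityʳ x))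
move-opposite N (x , y) = cong (x ,_) (trans (ℤP.+-assoc y (+ 1) (- + 1)) (ℤP.+-identityʳ y))
move-opposite S (x , y) = cong (x ,_) (trans (ℤP.+-assoc y (- + 1) (+ 1)) (ℤP.+-identityʳ y))

endFrom-reverseWalk : ∀ p u → endFrom (endFrom p u) (reverseWalk u) ≡ p
endFrom-reverseWalk p []      = refl
endFrom-reverseWalk p (s ∷ u) = begin
  endFrom (endFrom (move s p) u) (reverseWalk u ++ [ opposite s ])
    ≡⟨ endFrom-++ _ (reverseWalk u) _ ⟩
  move (opposite s) (endFrom (endFrom (move s p) u) (reverseWalk u))
    ≡⟨ cong (move (opposite s)) (endFrom-reverseWalk (move s p) u) ⟩
  move (opposite s) (move s p)
    ≡⟨ move-opposite s p ⟩
  p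
    ∎
  where open ≡-Reasoning

visits-reverseWalk : ∀ p u →
  visits (endFrom p u) (reverseWalk u) ≡ reverse (applyUpTo (λ t → endFrom p (take t u)) (length u))
visits-reverseWalk p []      = refl
visits-reverseWalk p (s ∷ u) = begin
  visits e (reverseWalk u ++ [ opposite s ])
    ≡⟨ visits-++ e (reverseWalk u) _ ⟩
  visits e (reverseWalk u) ∷ʳ move (opposite s) (endFrom e (reverseWalk u))
    ≡⟨ cong₂ _∷ʳ_ (visits-reverseWalk (move s p) u)
                  (trans (cong (move (opposite s)) (endFrom-reverseWalk (move s p) u)) (move-opposite s p)) ⟩
  reverse (applyUpTo (λ t → endFrom (move s p) (take t u)) (length u)) ∷ʳ p
    ≡⟨ List.unfold-reverse p (applyUpTo (λ t → endFrom (move s p) (take t u)) (length u)) ⟨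
  reverse (applyUpTo (λ t → endFrom p (take t (s ∷ u))) (length (s ∷ u)))
    ∎
  where
  open ≡-Reasoning
  e = endFrom (move s p) u

∑-steps-opposite : ∀ (F : Step → ℕ) → ∑[ s ∈ steps ] F (opposite s) ≡ ∑ steps F
∑-steps-opposite F =
  trans (x∙yz≈y∙xz (F W) (F E) _) (cong (λ z → F E + (F W + z)) (x∙yz≈y∙xz (F S) (F N) 0))

∑-words-reverseWalk : ∀ n (F : List Step → ℕ) → ∑ (words n) F ≡ ∑[ u ∈ words n ] F (reverseWalk u)
∑-words-reverseWalk zero    F = refl
∑-words-reverseWalk (suc n) F = sym (begin
  ∑[ u ∈ words (suc n) ] F (reverseWalk u)
    ≡⟨ ∑-words-suc n _ ⟩
  ∑[ s ∈ steps ] ∑[ u ∈ words n ] F (reverseWalk u ++ [ opposite s ])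
    ≡⟨ ∑-cong steps (λ s → sym (∑-words-reverseWalk n (λ u → F (u ++ [ opposite s ])))) ⟩
  ∑[ s ∈ steps ] ∑[ u ∈ words n ] F (u ++ [ opposite s ])
    ≡⟨ ∑-steps-opposite (λ s → ∑[ u ∈ words n ] F (u ++ [ s ])) ⟩
  ∑[ s ∈ steps ] ∑[ u ∈ words n ] F (u ++ [ s ])
    ≡⟨ ∑-swap steps (words n) (λ s u → F (u ++ [ s ])) ⟩
  ∑[ u ∈ words n ] ∑[ v ∈ words 1 ] F (u ++ v)
    ≡⟨ ∑-words-+ n 1 F ⟨
  ∑ (words (n + 1)) F
    ≡⟨ cong (λ m → ∑ (words m) F) (ℕP.+-comm n 1) ⟩
  ∑ (words (suc n)) F
    ∎)
  where open ≡-Reasoning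

-- Walk classes in terms of visited positions

NotBelow Above OnLevel : Point → Point → Set
NotBelow b q = proj₂ b ℤ.≤ proj₂ q
Above    b q = proj₂ b ℤ.< proj₂ q
OnLevel  b q = proj₂ q ≡ proj₂ b

AvoidsLeftRay AvoidsOpenLeftRay : Point → Point → Set
AvoidsLeftRay     b q = OnLevel b q → proj₁ b ℤ.< proj₁ q
AvoidsOpenLeftRay b q = OnLevel b q → proj₁ b ℤ.≤ proj₁ q

S-admissible L-admissible : Point → Point → Set
S-admissible b q = NotBelow b q × AvoidsLeftRay b q
L-admissible b q = NotBelow b q × AvoidsOpenLeftRay b q

positiveOrd : Point → Bool
positiveOrd (i , j) = does (+ 0 <? j)

isQ : List Step → Bool
isQ w = allB positiveOrd (visits origin w)

endsOnAxis : List Step → Bool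
endsOnAxis w = proj₂ (endpoint w) == + 0

T-allB : ∀ {A : Set} (p : A → Bool) xs → T (allB p xs) ⇔ All (T ∘ p) xs
T-allB p []       = mk⇔ (λ _ → []) (λ _ → _)
T-allB p (x ∷ xs) = mk⇔
  (λ h → let (px , pxs) = Equivalence.to T-∧ h in px ∷ Equivalence.to (T-allB p xs) pxs)
  (λ { (px ∷ pxs) → Equivalence.from T-∧ (px , Equivalence.from (T-allB p xs) pxs) })

T-not-∧ : ∀ {a b} → T (not (a ∧ b)) ⇔ (T a → ¬ T b)
T-not-∧ {true}  {true}  = mk⇔ (λ ()) (λ f → f _ _)
T-not-∧ {true}  {false} = mk⇔ (λ _ _ ()) (λ _ → _)
T-not-∧ {false}         = mk⇔ (λ _ ()) (λ _ → _)

T-injective : ∀ {a b} → T a ⇔ T b → a ≡ b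
T-injective {false} {false} _   = refl
T-injective {false} {true}  a⇔b = ⊥-elim (Equivalence.from a⇔b _)
T-injective {true}  {false} a⇔b = ⊥-elim (Equivalence.to a⇔b _)
T-injective {true}  {true}  _   = refl

≡⇒⇔ : ∀ {A B : Set} → A ≡ B → A ⇔ B
≡⇒⇔ refl = ⇔.refl

T-does : ∀ {P : Set} (P? : Dec P) → T (does P?) ⇔ P
T-does (yes p) = mk⇔ (λ _ → p) (λ _ → _)
T-does (no ¬p) = mk⇔ (λ ()) ¬p

==0⇔≡ : ∀ a b → T (a ℤ.- b == + 0) ⇔ (a ≡ b)
==0⇔≡ a b = ⇔.trans (T-does (a ℤ.- b ℤP.≟ + 0)) (mk⇔ (ℤP.i-j≡0⇒i≡j a b) ℤP.i≡j⇒i-j≡0)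

0≤-⇔ : ∀ a b → T (does (+ 0 ≤? a ℤ.- b)) ⇔ (b ℤ.≤ a)
0≤-⇔ a b = ⇔.trans (T-does (+ 0 ≤? a ℤ.- b)) (mk⇔ ℤP.0≤i-j⇒j≤i ℤP.i≤j⇒0≤j-i)

0<-⇔ : ∀ a b → T (does (+ 0 <? a ℤ.- b)) ⇔ (b ℤ.< a)
0<-⇔ a b = ⇔.trans (T-does (+ 0 <? a ℤ.- b)) (mk⇔
  (λ 0<a-b → ℤP.≰⇒> (λ a≤b → ℤP.<⇒≱ 0<a-b (ℤP.i≤j⇒i-j≤0 a≤b)))
  (λ b<a → ℤP.≰⇒> (λ a-b≤0 → ℤP.<⇒≱ b<a (ℤP.i-j≤0⇒i≤j a-b≤0))))

¬≤0-⇔ : ∀ a b → (¬ T (does (a ℤ.- b ≤? + 0))) ⇔ (b ℤ.< a)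
¬≤0-⇔ a b = mk⇔ (λ h → ℤP.≰⇒> (h ∘ from ∘ ℤP.i≤j⇒i-j≤0))
                (λ b<a h → ℤP.<⇒≱ b<a (ℤP.i-j≤0⇒i≤j (to h)))
  where open Equivalence (T-does (a ℤ.- b ≤? + 0))

¬<0-⇔ : ∀ a b → (¬ T (does (a ℤ.- b <? + 0))) ⇔ (b ℤ.≤ a)
¬<0-⇔ a b = mk⇔ (λ h → ℤP.≮⇒≥ (λ a<b → h (from (ℤP.≰⇒> (ℤP.<⇒≱ a<b ∘ ℤP.0≤i-j⇒j≤i)))))
                (λ b≤a h → ℤP.<⇒≱ (to h) (ℤP.i≤j⇒0≤j-i b≤a))
  where open Equivalence (T-does (a ℤ.- b <? + 0))

→-⇔ : ∀ {A A′ B B′ : Set} → A ⇔ A′ → B ⇔ B′ → (A → B) ⇔ (A′ → B′)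
→-⇔ A⇔A′ B⇔B′ = mk⇔ (λ f → Equivalence.to B⇔B′ ∘ f ∘ Equivalence.from A⇔A′)
                    (λ f → Equivalence.from B⇔B′ ∘ f ∘ Equivalence.to A⇔A′)

All-⇔ : ∀ {A : Set} {P Q : A → Set} → (∀ x → P x ⇔ Q x) → ∀ xs → All P xs ⇔ All Q xs
All-⇔ P⇔Q xs =
  mk⇔ (All.map (λ {x} → Equivalence.to (P⇔Q x))) (All.map (λ {x} → Equivalence.from (P⇔Q x)))

All-× : ∀ {A : Set} {P Q : A → Set} xs → (All P xs × All Q xs) ⇔ All (λ x → P x × Q x) xs
All-× xs = mk⇔ All.zip All.unzip

nonnegOrd-⊖ : ∀ b q → T (nonnegOrd (q ⊖ b)) ⇔ NotBelow b q
nonnegOrd-⊖ (a , b) (x , y) = 0≤-⇔ y b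

positiveOrd-⊖ : ∀ b q → T (positiveOrd (q ⊖ b)) ⇔ Above b q
positiveOrd-⊖ (a , b) (x , y) = 0<-⇔ y b

notOnNonposAxis-⊖ : ∀ b q → T (not (onNonposAxis (q ⊖ b))) ⇔ AvoidsLeftRay b q
notOnNonposAxis-⊖ (a , b) (x , y) = ⇔.trans T-not-∧ (→-⇔ (==0⇔≡ y b) (¬≤0-⇔ x a))

notOnNegAxis-⊖ : ∀ b q → T (not (onNegAxis (q ⊖ b))) ⇔ AvoidsOpenLeftRay b q
notOnNegAxis-⊖ (a , b) (x , y) = ⇔.trans T-not-∧ (→-⇔ (==0⇔≡ y b) (¬<0-⇔ x a))

module _ (b : Point) where

  allB-from : ∀ (g : Point → Bool) {G : Point → Set} → (∀ q → T (g (q ⊖ b)) ⇔ G q) →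
              ∀ x → T (allB g (visits origin x)) ⇔ All G (visits b x)
  allB-from g {G} g⇔G x = begin
    T (allB g (visits origin x))          ≡⟨ cong (T ∘ allB g) (visits-relative b x) ⟩
    T (allB g (map (_⊖ b) (visits b x)))  ∼⟨ T-allB g _ ⟩
    All (T ∘ g) (map (_⊖ b) (visits b x)) ∼⟨ mk⇔ All.map⁻ All.map⁺ ⟩
    All (T ∘ g ∘ (_⊖ b)) (visits b x)     ∼⟨ All-⇔ g⇔G (visits b x) ⟩
    All G (visits b x)                    ∎
    where open EquationalReasoning

  endsOnAxis-from : ∀ x → T (endsOnAxis x) ⇔ OnLevel b (endFrom b x)
  endsOnAxis-from x rewrite endpoint-relative b x = ==0⇔≡ _ _

  returns-from : ∀ x → T ((proj₁ (endpoint x) == + 0) ∧ (proj₂ (endpoint x) == + 0)) ⇔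
                       (endFrom b x ≡ b)
  returns-from x rewrite endpoint-relative b x = ⇔.trans T-∧ (⇔.trans (==0⇔≡ _ _ ×-⇔ ==0⇔≡ _ _)
    (mk⇔ (λ (x≡ , y≡) → cong₂ _,_ x≡ y≡) (λ e → cong proj₁ e , cong proj₂ e)))

  upper-from : ∀ x → T (upper x) ⇔ All (NotBelow b) (visits b x)
  upper-from = allB-from nonnegOrd (nonnegOrd-⊖ b)

  isQ-from : ∀ x → T (isQ x) ⇔ All (Above b) (visits b x)
  isQ-from = allB-from positiveOrd (positiveOrd-⊖ b)

  isS-from : ∀ x → T (isS x) ⇔ All (S-admissible b) (visits b x)
  isS-from x = ⇔.trans T-∧ (⇔.trans (upper-from x ×-⇔ allB-from _ (notOnNonposAxis-⊖ b) x) (All-× _))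

  isS0-from : ∀ x → T (isS0 x) ⇔ (All (S-admissible b) (visits b x) × OnLevel b (endFrom b x))
  isS0-from x = ⇔.trans T-∧ (isS-from x ×-⇔ endsOnAxis-from x)

  isL-from : ∀ x → T (isL x) ⇔ (All (L-admissible b) (visits b x) × endFrom b x ≡ b)
  isL-from x = begin
    T (isL x)
      ∼⟨ ⇔.trans T-∧ (⇔.refl ×-⇔ T-∧) ⟩
    (T (upper x) × T (allB (not ∘ onNegAxis) (visits origin x))
                 × T ((proj₁ (endpoint x) == + 0) ∧ (proj₂ (endpoint x) == + 0)))
      ∼⟨ upper-from x ×-⇔ allB-from _ (notOnNegAxis-⊖ b) x ×-⇔ returns-from x ⟩
    (All (NotBelow b) (visits b x) × All (AvoidsOpenLeftRay b) (visits b x) × endFrom b x ≡ b)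
      ∼⟨ mk⇔ (λ (p , q , r) → (p , q) , r) (λ ((p , q) , r) → p , q , r) ⟩
    ((All (NotBelow b) (visits b x) × All (AvoidsOpenLeftRay b) (visits b x)) × endFrom b x ≡ b)
      ∼⟨ All-× _ ×-⇔ ⇔.refl ⟩
    (All (L-admissible b) (visits b x) × endFrom b x ≡ b)
      ∎
    where open EquationalReasoning

position : List Step → ℕ → Point
position w t = endpoint (take t w)

segment : ℕ → ℕ → List Step → List Step
segment i k w = take (k ∸ i) (drop i w)

∀-interval : ∀ k j (F : ℕ → Set) →
             (∀ t → t < j ∸ k → F (k + suc t)) ⇔ (∀ s → k < s → s ≤ j → F s)
∀-interval k j F = mk⇔ (to k j F) (from k j F)
  where
  to : ∀ k j (F : ℕ → Set) → (∀ t → t < j ∸ k → F (k + suc t)) → ∀ s → k < s → s ≤ j → F s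
  to zero    j       F h (suc s) _         s≤j       = h s s≤j
  to (suc k) (suc j) F h (suc s) (s≤s k<s) (s≤s s≤j) = to k j (F ∘ suc) h s k<s s≤j
  from : ∀ k j (F : ℕ → Set) → (∀ s → k < s → s ≤ j → F s) → ∀ t → t < j ∸ k → F (k + suc t)
  from zero    j       F h t t<j = h (suc t) (s≤s z≤n) t<j
  from (suc k) (suc j) F h t t<  =
    from k j (F ∘ suc) (λ s k<s s≤j → h (suc s) (s≤s k<s) (s≤s s≤j)) t t<

applyUpTo-cong : ∀ {A : Set} {f g : ℕ → A} n → (∀ t → t < n → f t ≡ g t) →
                 applyUpTo f n ≡ applyUpTo g n
applyUpTo-cong zero    f≡g = refl
applyUpTo-cong (suc n) f≡g =
  cong₂ _∷_ (f≡g 0 (s≤s z≤n)) (applyUpTo-cong n (λ t t<n → f≡g (suc t) (s≤s t<n)))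

All-applyUpTo : ∀ {A : Set} {F : A → Set} (f : ℕ → A) n →
                All F (applyUpTo f n) ⇔ (∀ t → t < n → F (f t))
All-applyUpTo f n = mk⇔ (λ h t → All.applyUpTo⁻ f n h) (λ h → All.applyUpTo⁺₁ f n (h _))

All-reverse : ∀ {A : Set} {F : A → Set} xs → All F (reverse xs) ⇔ All F xs
All-reverse xs = mk⇔ (All-resp-↭ (↭-reverse xs)) (All-resp-↭ (↭-sym (↭-reverse xs)))

take-+ : ∀ {A : Set} k m (xs : List A) → take (k + m) xs ≡ take k xs ++ take m (drop k xs)
take-+ zero    m xs       = refl
take-+ (suc k) m []       = sym (List.take-[] m)
take-+ (suc k) m (x ∷ xs) = cong (x ∷_) (take-+ k m xs)

take-take-≤ : ∀ {A : Set} {m n} (xs : List A) → m ≤ n → take m (take n xs) ≡ take m xs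
take-take-≤ xs m≤n = trans (List.take-take _ _ xs) (cong (λ l → take l xs) (ℕP.m≤n⇒m⊓n≡m m≤n))

length-take-≤ : ∀ {A : Set} {m} (xs : List A) → m ≤ length xs → length (take m xs) ≡ m
length-take-≤ xs m≤∣xs∣ = trans (List.length-take _ xs) (ℕP.m≤n⇒m⊓n≡m m≤∣xs∣)

module Positions (w : List Step) where

  private
    n = length w
    P = position w

  endFrom-take-drop : ∀ k m → endFrom (P k) (take m (drop k w)) ≡ P (k + m)
  endFrom-take-drop k m = sym (trans (cong endpoint (take-+ k m w)) (endFrom-++ origin (take k w) _))

  visits-take-drop : ∀ k m → k + m ≤ n →
                     visits (P k) (take m (drop k w)) ≡ applyUpTo (λ t → P (k + suc t)) m
  visits-take-drop k m k+m≤n = begin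
    visits (P k) x                                               ≡⟨ visits-applyUpTo (P k) x ⟩
    applyUpTo (λ t → endFrom (P k) (take (suc t) x)) (length x)  ≡⟨ cong (applyUpTo _) ∣x∣≡m ⟩
    applyUpTo (λ t → endFrom (P k) (take (suc t) x)) m           ≡⟨ applyUpTo-cong m step ⟩
    applyUpTo (λ t → P (k + suc t)) m                            ∎
    where
    open ≡-Reasoning
    x = take m (drop k w)
    ∣x∣≡m : length x ≡ m
    ∣x∣≡m = length-take-≤ (drop k w) (subst (m ≤_) (sym (List.length-drop k w))
                                            (ℕP.m+n≤o⇒m≤o∸n m (subst (_≤ n) (ℕP.+-comm k m) k+m≤n)))
    step : ∀ t → t < m → endFrom (P k) (take (suc t) x) ≡ P (k + suc t)
    step t t<m = trans (cong (endFrom (P k)) (take-take-≤ (drop k w) t<m)) (endFrom-take-drop k (suc t))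

  endFrom-segment : ∀ {k j} → k ≤ j → endFrom (P k) (segment k j w) ≡ P j
  endFrom-segment {k} {j} k≤j = trans (endFrom-take-drop k (j ∸ k)) (cong P (ℕP.m+[n∸m]≡n k≤j))

  All-segment : ∀ {k j} (F : Point → Set) → k ≤ j → j ≤ n →
                All F (visits (P k) (segment k j w)) ⇔ (∀ s → k < s → s ≤ j → F (P s))
  All-segment {k} {j} F k≤j j≤n = begin
    All F (visits (P k) (segment k j w))             ≡⟨ cong (All F) (visits-take-drop k (j ∸ k) k+[j∸k]≤n) ⟩
    All F (applyUpTo (λ t → P (k + suc t)) (j ∸ k))  ∼⟨ All-applyUpTo _ (j ∸ k) ⟩
    (∀ t → t < j ∸ k → F (P (k + suc t)))            ∼⟨ ∀-interval k j (F ∘ P) ⟩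
    (∀ s → k < s → s ≤ j → F (P s))                  ∎
    where
    open EquationalReasoning
    k+[j∸k]≤n = subst (_≤ n) (sym (ℕP.m+[n∸m]≡n k≤j)) j≤n

  class-segment : ∀ {c : List Step → Bool} {G : Point → Point → Set} {k j} →
                  (∀ b x → T (c x) ⇔ All (G b) (visits b x)) → k ≤ j → j ≤ n →
                  T (c (segment k j w)) ⇔ (∀ s → k < s → s ≤ j → G (P k) (P s))
  class-segment {k = k} c-from k≤j j≤n = ⇔.trans (c-from (P k) _) (All-segment _ k≤j j≤n)

  endsOnAxis-segment : ∀ {k j} → k ≤ j → T (endsOnAxis (segment k j w)) ⇔ OnLevel (P k) (P j)
  endsOnAxis-segment {k} {j} k≤j =
    ⇔.trans (endsOnAxis-from (P k) (segment k j w)) (≡⇒⇔ (cong (OnLevel (P k)) (endFrom-segment k≤j)))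

  isS0-segment : ∀ {k j} → k ≤ j → j ≤ n →
                 T (isS0 (segment k j w)) ⇔
                 ((∀ s → k < s → s ≤ j → S-admissible (P k) (P s)) × OnLevel (P k) (P j))
  isS0-segment k≤j j≤n = ⇔.trans T-∧ (class-segment isS-from k≤j j≤n ×-⇔ endsOnAxis-segment k≤j)

  isL-segment : ∀ {k j} → k ≤ j → j ≤ n →
                T (isL (segment k j w)) ⇔ ((∀ s → k < s → s ≤ j → L-admissible (P k) (P s)) × P j ≡ P k)
  isL-segment {k} k≤j j≤n = ⇔.trans (isL-from (P k) _)
    (All-segment _ k≤j j≤n ×-⇔ ≡⇒⇔ (cong (_≡ P k) (endFrom-segment k≤j)))

  drop≡segment : ∀ k → drop k w ≡ segment k n w
  drop≡segment k = sym (List.take-all (n ∸ k) (drop k w) (ℕP.≤-reflexive (List.length-drop k w)))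

  endFrom-reversedPrefix : ∀ i → endFrom (P i) (reverseWalk (take i w)) ≡ P 0
  endFrom-reversedPrefix i = endFrom-reverseWalk origin (take i w)

  All-reversedPrefix : ∀ {i} (F : Point → Set) → i ≤ n →
                       All F (visits (P i) (reverseWalk (take i w))) ⇔ (∀ s → s < i → F (P s))
  All-reversedPrefix {i} F i≤n = begin
    All F (visits (P i) (reverseWalk u))  ≡⟨ cong (All F) visits≡ ⟩
    All F (reverse (applyUpTo P i))       ∼⟨ All-reverse (applyUpTo P i) ⟩
    All F (applyUpTo P i)                 ∼⟨ All-applyUpTo P i ⟩
    (∀ s → s < i → F (P s))               ∎
    where
    open EquationalReasoning
    u = take i w
    visits≡ : visits (P i) (reverseWalk u) ≡ reverse (applyUpTo P i)
    visits≡ = trans (visits-reverseWalk origin u) (cong reverse (trans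
      (cong (applyUpTo _) (length-take-≤ w i≤n))
      (applyUpTo-cong i (λ t t<i → cong endpoint (take-take-≤ w (ℕP.<⇒≤ t<i))))))

  isS0-reversedPrefix : ∀ {i} → i ≤ n →
    T (isS0 (reverseWalk (take i w))) ⇔ ((∀ s → s < i → S-admissible (P i) (P s)) × OnLevel (P i) (P 0))
  isS0-reversedPrefix {i} i≤n = ⇔.trans (isS0-from (P i) _)
    (All-reversedPrefix _ i≤n ×-⇔ ≡⇒⇔ (cong (OnLevel (P i)) (endFrom-reversedPrefix i)))

-- Minimisers and factorisations of position sequences

≤-suc-extend : ∀ {P : ℕ → Set} {n} → (∀ s → s ≤ n → P s) → P (suc n) → ∀ s → s ≤ suc n → P s
≤-suc-extend below top s s≤1+n with ℕP.m≤n⇒m<n∨m≡n s≤1+n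
... | inj₁ s<1+n = below s (ℕP.≤-pred s<1+n)
... | inj₂ refl  = top

module _ (A : ℕ → Set) (f : ℕ → ℤ) where

  record IsFirstMinimiser (n i : ℕ) : Set where
    field
      bound   : i ≤ n
      member  : A i
      minimal : ∀ s → s ≤ n → A s → f i ℤ.≤ f s
      first   : ∀ s → s < i → A s → f i ℤ.< f s

  record IsLastMinimiser (n k : ℕ) : Set where
    field
      bound   : k ≤ n
      member  : A k
      minimal : ∀ s → s ≤ n → A s → f k ℤ.≤ f s
      last    : ∀ s → k < s → s ≤ n → A s → f k ℤ.< f s

  firstMinimiser-unique : ∀ {n i i′} → IsFirstMinimiser n i → IsFirstMinimiser n i′ → i ≡ i′
  firstMinimiser-unique m m′ = ℕP.≤-antisym (ℕP.≮⇒≥ (notBefore m′ m)) (ℕP.≮⇒≥ (notBefore m m′))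
    where
    notBefore : ∀ {n i i′} → IsFirstMinimiser n i → IsFirstMinimiser n i′ → ¬ i < i′
    notBefore m m′ i<i′ = ℤP.<⇒≱ (M′.first _ i<i′ M.member) (M.minimal _ M′.bound M′.member)
      where
      module M = IsFirstMinimiser m
      module M′ = IsFirstMinimiser m′

  lastMinimiser-unique : ∀ {n k k′} → IsLastMinimiser n k → IsLastMinimiser n k′ → k ≡ k′
  lastMinimiser-unique m m′ = ℕP.≤-antisym (ℕP.≮⇒≥ (notAfter m m′)) (ℕP.≮⇒≥ (notAfter m′ m))
    where
    notAfter : ∀ {n k k′} → IsLastMinimiser n k → IsLastMinimiser n k′ → ¬ k′ < k
    notAfter m m′ k′<k = ℤP.<⇒≱ (M′.last _ k′<k M.bound M.member) (M.minimal _ M′.bound M′.member)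
      where
      module M = IsLastMinimiser m
      module M′ = IsLastMinimiser m′

  private
    firstMinimiser-keep : ∀ {n i} → IsFirstMinimiser n i → (A (suc n) → f i ℤ.≤ f (suc n)) →
                          IsFirstMinimiser (suc n) i
    firstMinimiser-keep m fi≤ = record
      { bound = ℕP.m≤n⇒m≤1+n bound ; member = member ; minimal = ≤-suc-extend minimal fi≤ ; first = first }
      where open IsFirstMinimiser m

    firstMinimiser-new : ∀ {n i} → IsFirstMinimiser n i → A (suc n) → f (suc n) ℤ.< f i →
                         IsFirstMinimiser (suc n) (suc n)
    firstMinimiser-new m An f< = record
      { bound   = ℕP.≤-refl
      ; member  = An
      ; minimal = ≤-suc-extend (λ s s≤n As → ℤP.<⇒≤ (ℤP.<-≤-trans f< (minimal s s≤n As))) (λ _ → ℤP.≤-refl)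
      ; first   = λ s s<1+n As → ℤP.<-≤-trans f< (minimal s (ℕP.≤-pred s<1+n) As) }
      where open IsFirstMinimiser m

    lastMinimiser-keep : ∀ {n k} → IsLastMinimiser n k → (A (suc n) → f k ℤ.< f (suc n)) →
                         IsLastMinimiser (suc n) k
    lastMinimiser-keep m fk< = record
      { bound   = ℕP.m≤n⇒m≤1+n bound
      ; member  = member
      ; minimal = ≤-suc-extend minimal (ℤP.<⇒≤ ∘ fk<)
      ; last    = λ s k<s s≤1+n → ≤-suc-extend (λ s s≤n k<s → last s k<s s≤n) (λ _ → fk<) s s≤1+n k<s }
      where open IsLastMinimiser m

    lastMinimiser-new : ∀ {n k} → IsLastMinimiser n k → A (suc n) → f (suc n) ℤ.≤ f k →
                        IsLastMinimiser (suc n) (suc n)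
    lastMinimiser-new m An f≤ = record
      { bound   = ℕP.≤-refl
      ; member  = An
      ; minimal = ≤-suc-extend (λ s s≤n As → ℤP.≤-trans f≤ (minimal s s≤n As)) (λ _ → ℤP.≤-refl)
      ; last    = λ s 1+n<s s≤1+n _ → ⊥-elim (ℕP.<⇒≱ 1+n<s s≤1+n) }
      where open IsLastMinimiser m

  module _ (A? : Decidable A) (A0 : A 0) where

    firstMinimiser : ∀ n → ∃ (IsFirstMinimiser n)
    firstMinimiser zero = 0 , record
      { bound = z≤n ; member = A0 ; minimal = λ { zero z≤n _ → ℤP.≤-refl } ; first = λ _ () }
    firstMinimiser (suc n) with firstMinimiser n
    ... | i , m with A? (suc n)
    ...   | no ¬An = i , firstMinimiser-keep m (⊥-elim ∘ ¬An)
    ...   | yes An with f (suc n) ℤP.<? f i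
    ...     | yes f< = suc n , firstMinimiser-new m An f<
    ...     | no ¬f< = i , firstMinimiser-keep m (λ _ → ℤP.≮⇒≥ ¬f<)

    lastMinimiser : ∀ n → ∃ (IsLastMinimiser n)
    lastMinimiser zero = 0 , record
      { bound = z≤n ; member = A0 ; minimal = λ { zero z≤n _ → ℤP.≤-refl } ; last = λ { _ () z≤n } }
    lastMinimiser (suc n) with lastMinimiser n
    ... | k , m with A? (suc n)
    ...   | no ¬An = k , lastMinimiser-keep m (⊥-elim ∘ ¬An)
    ...   | yes An with f (suc n) ℤP.≤? f k
    ...     | yes f≤ = suc n , lastMinimiser-new m An f≤
    ...     | no ¬f≤ = k , lastMinimiser-keep m (λ _ → ℤP.≰⇒> ¬f≤)

module MotzkinFactorisation (P : ℕ → Point) (n : ℕ) where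

  private
    X Y : ℕ → ℤ
    X = proj₁ ∘ P
    Y = proj₂ ∘ P
    OnAxis : ℕ → Set
    OnAxis s = OnLevel (P 0) (P s)

  IsMotzkin : Set
  IsMotzkin = (∀ s → 0 < s → s ≤ n → NotBelow (P 0) (P s)) × OnLevel (P 0) (P n)

  record Factorisation (i k : ℕ) : Set where
    field
      i≤k          : i ≤ k
      k≤n          : k ≤ n
      prefix       : ∀ s → s < i → S-admissible (P i) (P s)
      prefix-level : OnLevel (P i) (P 0)
      loop         : ∀ s → i < s → s ≤ k → L-admissible (P i) (P s)
      loop-closed  : P k ≡ P i
      suffix       : ∀ s → k < s → s ≤ n → S-admissible (P k) (P s)
      suffix-level : OnLevel (P k) (P n)

  module _ {i k} (F : Factorisation i k) where
    open Factorisation F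

    private
      Yk≡Yi : Y k ≡ Y i
      Yk≡Yi = cong proj₂ loop-closed

      notBelow-i : ∀ s → s ≤ n → Y i ℤ.≤ Y s
      notBelow-i s s≤n with ℕP.<-cmp s i | ℕP.≤-<-connex s k
      ... | tri< s<i _ _ | _        = proj₁ (prefix s s<i)
      ... | tri≈ _ refl _ | _       = ℤP.≤-refl
      ... | tri> _ _ i<s | inj₁ s≤k = proj₁ (loop s i<s s≤k)
      ... | tri> _ _ i<s | inj₂ k<s = subst (ℤ._≤ Y s) Yk≡Yi (proj₁ (suffix s k<s s≤n))

      leftmost-i : ∀ s → s ≤ n → Y s ≡ Y i → X i ℤ.≤ X s
      leftmost-i s s≤n Ys≡Yi with ℕP.<-cmp s i | ℕP.≤-<-connex s k
      ... | tri< s<i _ _ | _        = ℤP.<⇒≤ (proj₂ (prefix s s<i) Ys≡Yi)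
      ... | tri≈ _ refl _ | _       = ℤP.≤-refl
      ... | tri> _ _ i<s | inj₁ s≤k = proj₂ (loop s i<s s≤k) Ys≡Yi
      ... | tri> _ _ i<s | inj₂ k<s = subst (ℤ._≤ X s) (cong proj₁ loop-closed)
                                        (ℤP.<⇒≤ (proj₂ (suffix s k<s s≤n) (trans Ys≡Yi (sym Yk≡Yi))))

    factorisation⇒motzkin : IsMotzkin
    factorisation⇒motzkin =
      (λ s _ s≤n → subst (ℤ._≤ Y s) (sym prefix-level) (notBelow-i s s≤n)) ,
      trans suffix-level (trans Yk≡Yi (sym prefix-level))

    firstMinimiser-i : IsFirstMinimiser OnAxis X n i
    firstMinimiser-i = record
      { bound   = ℕP.≤-trans i≤k k≤n
      ; member  = sym prefix-level
      ; minimal = λ s s≤n s∈axis → leftmost-i s s≤n (trans s∈axis prefix-level)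
      ; first   = λ s s<i s∈axis → proj₂ (prefix s s<i) (trans s∈axis prefix-level) }

    lastMinimiser-k : IsLastMinimiser OnAxis X n k
    lastMinimiser-k = record
      { bound   = k≤n
      ; member  = trans Yk≡Yi (sym prefix-level)
      ; minimal = λ s s≤n s∈axis → subst (ℤ._≤ X s) (sym (cong proj₁ loop-closed))
                                     (leftmost-i s s≤n (trans s∈axis prefix-level))
      ; last    = λ s k<s s≤n s∈axis →
                    proj₂ (suffix s k<s s≤n) (trans s∈axis (trans prefix-level (sym Yk≡Yi))) }

  factorisation-unique : ∀ {i k i′ k′} → Factorisation i k → Factorisation i′ k′ →
                         i ≡ i′ × k ≡ k′
  factorisation-unique F F′ =
    firstMinimiser-unique OnAxis X (firstMinimiser-i F) (firstMinimiser-i F′) ,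
    lastMinimiser-unique OnAxis X (lastMinimiser-k F) (lastMinimiser-k F′)

  motzkin⇒factorisation : IsMotzkin → ∃[ i ] ∃[ k ] Factorisation i k
  motzkin⇒factorisation (notBelow , ends) = i , k , record
    { i≤k          = i≤k
    ; k≤n          = K.bound
    ; prefix       = λ s s<i → above-i s (ℕP.<⇒≤ (ℕP.<-≤-trans s<i I.bound)) ,
                               λ Ys≡Yi → I.first s s<i (trans Ys≡Yi I.member)
    ; prefix-level = sym I.member
    ; loop         = λ s _ s≤k → above-i s (ℕP.≤-trans s≤k K.bound) ,
                                 λ Ys≡Yi → I.minimal s (ℕP.≤-trans s≤k K.bound) (trans Ys≡Yi I.member)
    ; loop-closed  = cong₂ _,_ (sym Xi≡Xk) (trans K.member (sym I.member))
    ; suffix       = λ s k<s s≤n → subst (ℤ._≤ Y s) (sym K.member) (base≤ s s≤n) ,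
                                   λ Ys≡Yk → K.last s k<s s≤n (trans Ys≡Yk K.member)
    ; suffix-level = trans ends (sym K.member)
    }
    where
    onAxis? : Decidable OnAxis
    onAxis? s = Y s ℤP.≟ Y 0
    -- i and k are the first and the last visit to the leftmost point visited on the x-axis.
    first = firstMinimiser OnAxis X onAxis? refl n
    last  = lastMinimiser OnAxis X onAxis? refl n
    i = proj₁ first
    k = proj₁ last
    module I = IsFirstMinimiser (proj₂ first)
    module K = IsLastMinimiser (proj₂ last)
    Xi≡Xk : X i ≡ X k
    Xi≡Xk = ℤP.≤-antisym (I.minimal k K.bound K.member) (K.minimal i I.bound I.member)
    i≤k : i ≤ k
    i≤k = ℕP.≮⇒≥ (λ k<i → ℤP.<-irrefl Xi≡Xk (I.first k k<i K.member))
    base≤ : ∀ s → s ≤ n → Y 0 ℤ.≤ Y s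
    base≤ zero    _   = ℤP.≤-refl
    base≤ (suc s) s≤n = notBelow (suc s) (s≤s z≤n) s≤n
    above-i : ∀ s → s ≤ n → Y i ℤ.≤ Y s
    above-i s s≤n = subst (ℤ._≤ Y s) (sym I.member) (base≤ s s≤n)

module LastAxisVisit (P : ℕ → Point) (n : ℕ) (G : Point → Set)
                     (G⇒notBelow : ∀ {q} → G q → NotBelow (P 0) q)
                     (above⇒G : ∀ {q} → Above (P 0) q → G q) where

  private
    Y : ℕ → ℤ
    Y = proj₂ ∘ P
    OnAxis : ℕ → Set
    OnAxis s = OnLevel (P 0) (P s)

  record Split (k : ℕ) : Set where
    field
      k≤n       : k ≤ n
      prefix    : ∀ s → 0 < s → s ≤ k → G (P s)
      k-on-axis : OnLevel (P 0) (P k)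
      excursion : ∀ s → k < s → s ≤ n → Above (P k) (P s)

  split⇒all : ∀ {k} → Split k → ∀ s → 0 < s → s ≤ n → G (P s)
  split⇒all {k} L s 0<s s≤n = [ prefix s 0<s , from-excursion ]′ (ℕP.≤-<-connex s k)
    where
    open Split L
    from-excursion : k < s → G (P s)
    from-excursion k<s = above⇒G (subst (ℤ._< Y s) k-on-axis (excursion s k<s s≤n))

  split-unique : ∀ {k k′} → Split k → Split k′ → k ≡ k′
  split-unique L L′ = lastMinimiser-unique OnAxis (const (+ 0)) (lastOnAxis L) (lastOnAxis L′)
    where
    lastOnAxis : ∀ {k} → Split k → IsLastMinimiser OnAxis (const (+ 0)) n k
    lastOnAxis L = record
      { bound = k≤n ; member = k-on-axis ; minimal = λ _ _ _ → ℤP.≤-refl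
      ; last = λ s k<s s≤n s∈axis →
          ⊥-elim (ℤP.<-irrefl (trans k-on-axis (sym s∈axis)) (excursion s k<s s≤n)) }
      where open Split L

  all⇒split : (∀ s → 0 < s → s ≤ n → G (P s)) → ∃ Split
  all⇒split all = k , record
    { k≤n       = K.bound
    ; prefix    = λ s 0<s s≤k → all s 0<s (ℕP.≤-trans s≤k K.bound)
    ; k-on-axis = K.member
    ; excursion = λ s k<s s≤n → subst (ℤ._< Y s) (sym K.member) (ℤP.≤∧≢⇒<
        (G⇒notBelow (all s (ℕP.≤-<-trans z≤n k<s) s≤n))
        (λ Y0≡Ys → ℤP.<-irrefl refl (K.last s k<s s≤n (sym Y0≡Ys))))
    }
    where
    -- For a constant key the last minimiser is the last visit to the axis.
    last = lastMinimiser OnAxis (const (+ 0)) (λ s → Y s ℤP.≟ Y 0) refl n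
    k = proj₁ last
    module K = IsLastMinimiser (proj₂ last)

-- Unique factorisations of walks and their generating functions

take-++ˡ : ∀ {A : Set} (u v : List A) → take (length u) (u ++ v) ≡ u
take-++ˡ []      v = refl
take-++ˡ (x ∷ u) v = cong (x ∷_) (take-++ˡ u v)

drop-++ˡ : ∀ {A : Set} (u v : List A) → drop (length u) (u ++ v) ≡ v
drop-++ˡ []      v = refl
drop-++ˡ (x ∷ u) v = drop-++ˡ u v

∑-gf-when : ∀ q m a (f : Point → ℕ) →
            ∑ (gf q m) f when a ≡ ∑[ v ∈ words m ] (f (endpoint v) when (a ∧ q v))
∑-gf-when q m a f = begin
  ∑ (gf q m) f when a                                  ≡⟨ cong (_when a) (∑-gf q m f) ⟩
  ∑[ v ∈ words m ] (f (endpoint v) when q v) when a    ≡⟨ ∑-when (words m) _ a ⟨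
  ∑[ v ∈ words m ] (f (endpoint v) when q v when a)    ≡⟨ ∑-cong (words m) (λ v → when-∧ _ a (q v)) ⟨
  ∑[ v ∈ words m ] (f (endpoint v) when (a ∧ q v))     ∎
  where open ≡-Reasoning

∑-gf⊛gf : ∀ p q n (h : Point → ℕ) →
  ∑ ((gf p ⊛ gf q) n) h ≡
  ∑[ k < suc n ] ∑[ u ∈ words k ] ∑[ v ∈ words (n ∸ k) ] (h (addP (endpoint u) (endpoint v)) when (p u ∧ q v))
∑-gf⊛gf p q n h = trans (∑-⊛ (gf p) (gf q) n h) (∑<-cong (suc n) λ k _ →
  trans (∑-gf p k _) (∑-cong (words k) λ u → ∑-gf-when q (n ∸ k) (p u) (h ∘ addP (endpoint u))))

∑-gf⊛gf⊛gf : ∀ p q r n (h : Point → ℕ) →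
  ∑ (((gf p ⊛ gf q) ⊛ gf r) n) h ≡
  ∑[ k < suc n ] ∑[ i < suc k ] ∑[ u ∈ words i ] ∑[ v ∈ words (k ∸ i) ] ∑[ z ∈ words (n ∸ k) ]
    (h (addP (addP (endpoint u) (endpoint v)) (endpoint z)) when ((p u ∧ q v) ∧ r z))
∑-gf⊛gf⊛gf p q r n h = trans (∑-⊛ (gf p ⊛ gf q) (gf r) n h) (∑<-cong (suc n) λ k _ →
  trans (∑-gf⊛gf p q k _) (∑<-cong (suc k) λ i _ → ∑-cong (words i) λ u → ∑-cong (words (k ∸ i)) λ v →
    ∑-gf-when r (n ∸ k) (p u ∧ q v) (h ∘ addP (addP (endpoint u) (endpoint v)))))

gf-factorisation₂ : ∀ (b p q : List Step → Bool) →
  (∀ w x → x when b w ≡ ∑[ k < suc (length w) ] (x when (p (take k w) ∧ q (drop k w)))) →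
  gf b ≋ gf p ⊛ gf q
gf-factorisation₂ b p q split .∑-≡ n h = begin
  ∑ (gf b n) h
    ≡⟨ ∑-gf b n h ⟩
  ∑[ w ∈ words n ] (h (endpoint w) when b w)
    ≡⟨ ∑-words-cong n (λ w ∣w∣≡n → trans (split w _) (cong (λ m → ∑< (suc m) (F w)) ∣w∣≡n)) ⟩
  ∑[ w ∈ words n ] ∑[ k < suc n ] F w k
    ≡⟨ ∑<-∑ (suc n) (words n) (λ k w → F w k) ⟨
  ∑[ k < suc n ] ∑[ w ∈ words n ] F w k
    ≡⟨ ∑<-cong (suc n) (λ k k<1+n → ∑-words-split (λ w → F w k) (ℕP.≤-pred k<1+n)) ⟩
  ∑[ k < suc n ] ∑[ u ∈ words k ] ∑[ v ∈ words (n ∸ k) ] F (u ++ v) k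
    ≡⟨ ∑<-cong (suc n) (λ k _ → ∑-words-cong k λ u ∣u∣≡k → ∑-cong (words (n ∸ k)) λ v → pieces u v ∣u∣≡k) ⟩
  ∑[ k < suc n ] ∑[ u ∈ words k ] ∑[ v ∈ words (n ∸ k) ] (h (addP (endpoint u) (endpoint v)) when (p u ∧ q v))
    ≡⟨ ∑-gf⊛gf p q n h ⟨
  ∑ ((gf p ⊛ gf q) n) h
    ∎
  where
  open ≡-Reasoning
  F : List Step → ℕ → ℕ
  F w k = h (endpoint w) when (p (take k w) ∧ q (drop k w))
  pieces : ∀ {k} u v → length u ≡ k → F (u ++ v) k ≡ h (addP (endpoint u) (endpoint v)) when (p u ∧ q v)
  pieces u v refl = cong₂ (λ e c → h e when c) (endpoint-++ u v)
                          (cong₂ (λ x y → p x ∧ q y) (take-++ˡ u v) (drop-++ˡ u v))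

gf-factorisation₃ : ∀ (b p q r : List Step → Bool) →
  (∀ w x → x when b w ≡
     ∑[ k < suc (length w) ] ∑[ i < suc k ] (x when ((p (take i w) ∧ q (segment i k w)) ∧ r (drop k w)))) →
  gf b ≋ (gf p ⊛ gf q) ⊛ gf r
gf-factorisation₃ b p q r split .∑-≡ n h = begin
  ∑ (gf b n) h
    ≡⟨ ∑-gf b n h ⟩
  ∑[ w ∈ words n ] (h (endpoint w) when b w)
    ≡⟨ ∑-words-cong n (λ w ∣w∣≡n →
         trans (split w _) (cong (λ m → ∑[ k < suc m ] ∑< (suc k) (F w k)) ∣w∣≡n)) ⟩
  ∑[ w ∈ words n ] ∑[ k < suc n ] ∑[ i < suc k ] F w k i
    ≡⟨ ∑<-∑ (suc n) (words n) (λ k w → ∑< (suc k) (F w k)) ⟨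
  ∑[ k < suc n ] ∑[ w ∈ words n ] ∑[ i < suc k ] F w k i
    ≡⟨ ∑<-cong (suc n) (λ k _ → ∑<-∑ (suc k) (words n) (λ i w → F w k i)) ⟨
  ∑[ k < suc n ] ∑[ i < suc k ] ∑[ w ∈ words n ] F w k i
    ≡⟨ ∑<-cong (suc n) (λ k k<1+n → ∑<-cong (suc k) λ i i<1+k →
         trans (∑-words-split (λ w → F w k i) (ℕP.≤-pred k<1+n))
               (∑-words-split (λ a → ∑[ z ∈ words (n ∸ k) ] F (a ++ z) k i) (ℕP.≤-pred i<1+k))) ⟩
  ∑[ k < suc n ] ∑[ i < suc k ] ∑[ u ∈ words i ] ∑[ v ∈ words (k ∸ i) ] ∑[ z ∈ words (n ∸ k) ]
    F ((u ++ v) ++ z) k i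
    ≡⟨ ∑<-cong (suc n) (λ k _ → ∑<-cong (suc k) λ i i<1+k →
         ∑-words-cong i λ u ∣u∣≡i → ∑-words-cong (k ∸ i) λ v ∣v∣≡k∸i → ∑-cong (words (n ∸ k)) λ z →
           pieces u v z ∣u∣≡i ∣v∣≡k∸i (ℕP.≤-pred i<1+k)) ⟩
  ∑[ k < suc n ] ∑[ i < suc k ] ∑[ u ∈ words i ] ∑[ v ∈ words (k ∸ i) ] ∑[ z ∈ words (n ∸ k) ]
    (h (addP (addP (endpoint u) (endpoint v)) (endpoint z)) when ((p u ∧ q v) ∧ r z))
    ≡⟨ ∑-gf⊛gf⊛gf p q r n h ⟨
  ∑ (((gf p ⊛ gf q) ⊛ gf r) n) h
    ∎
  where
  open ≡-Reasoning
  F : List Step → ℕ → ℕ → ℕ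
  F w k i = h (endpoint w) when ((p (take i w) ∧ q (segment i k w)) ∧ r (drop k w))
  pieces : ∀ {i k} u v z → length u ≡ i → length v ≡ k ∸ i → i ≤ k →
           F ((u ++ v) ++ z) k i ≡
           h (addP (addP (endpoint u) (endpoint v)) (endpoint z)) when ((p u ∧ q v) ∧ r z)
  pieces {i} {k} u v z refl ∣v∣≡k∸i i≤k = cong₂ (λ e c → h e when c)
    (trans (endpoint-++ (u ++ v) z) (cong (λ e → addP e (endpoint z)) (endpoint-++ u v)))
    (trans (cong₂ (λ x y → (p x ∧ q y) ∧ r (drop k ((u ++ v) ++ z))) u-piece v-piece)
           (cong (λ y → (p u ∧ q v) ∧ r y) z-piece))
    where
    w≡ : (u ++ v) ++ z ≡ u ++ (v ++ z)
    w≡ = List.++-assoc u v z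
    u-piece : take i ((u ++ v) ++ z) ≡ u
    u-piece = trans (cong (take i) w≡) (take-++ˡ u (v ++ z))
    v-piece : segment i k ((u ++ v) ++ z) ≡ v
    v-piece = trans (cong (λ x → take (k ∸ i) (drop i x)) w≡)
                    (trans (cong (take (k ∸ i)) (drop-++ˡ u (v ++ z)))
                           (subst (λ m → take m (v ++ z) ≡ v) ∣v∣≡k∸i (take-++ˡ v z)))
    z-piece : drop k ((u ++ v) ++ z) ≡ z
    z-piece = subst (λ m → drop m ((u ++ v) ++ z) ≡ z)
                    (trans (List.length-++ u) (trans (cong (_+_ (length u)) ∣v∣≡k∸i) (ℕP.m+[n∸m]≡n i≤k)))
                    (drop-++ˡ (u ++ v) z)

factorsAt : List Step → ℕ → ℕ → Bool
factorsAt w i k = (isS0 (reverseWalk (take i w)) ∧ isL (segment i k w)) ∧ isS0 (drop k w)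

module _ (w : List Step) where

  open Positions w
  open MotzkinFactorisation (position w) (length w)

  private
    n = length w
    P = position w

  isM⇔IsMotzkin : T (isM w) ⇔ IsMotzkin
  isM⇔IsMotzkin = begin
    T (isM w)                                     ≡⟨ cong (T ∘ isM) (drop≡segment 0) ⟩
    T (isM (segment 0 n w))                       ∼⟨ T-∧ ⟩
    (T (upper (segment 0 n w)) × T (endsOnAxis (segment 0 n w)))
      ∼⟨ class-segment upper-from z≤n ℕP.≤-refl ×-⇔ endsOnAxis-segment {j = n} z≤n ⟩
    IsMotzkin                                     ∎
    where open EquationalReasoning

  factorsAt⇔Factorisation : ∀ {i k} → i ≤ k → k ≤ n → T (factorsAt w i k) ⇔ Factorisation i k
  factorsAt⇔Factorisation {i} {k} i≤k k≤n = begin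
    T (factorsAt w i k)
      ≡⟨ cong (λ z → T ((isS0 (reverseWalk (take i w)) ∧ isL (segment i k w)) ∧ isS0 z)) (drop≡segment k) ⟩
    T ((isS0 (reverseWalk (take i w)) ∧ isL (segment i k w)) ∧ isS0 (segment k n w))
      ∼⟨ ⇔.trans T-∧ (T-∧ ×-⇔ ⇔.refl) ⟩
    ((T (isS0 (reverseWalk (take i w))) × T (isL (segment i k w))) × T (isS0 (segment k n w)))
      ∼⟨ (isS0-reversedPrefix (ℕP.≤-trans i≤k k≤n) ×-⇔ isL-segment i≤k k≤n) ×-⇔ isS0-segment k≤n ℕP.≤-refl ⟩
    ((((∀ s → s < i → S-admissible (P i) (P s)) × OnLevel (P i) (P 0))
      × ((∀ s → i < s → s ≤ k → L-admissible (P i) (P s)) × P k ≡ P i))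
      × ((∀ s → k < s → s ≤ n → S-admissible (P k) (P s)) × OnLevel (P k) (P n)))
      ∼⟨ mk⇔ (λ (((a , b) , (c , d)) , (e , f)) → record
                { i≤k = i≤k ; k≤n = k≤n ; prefix = a ; prefix-level = b ; loop = c ; loop-closed = d
                ; suffix = e ; suffix-level = f })
             (λ F → ((prefix F , prefix-level F) , (loop F , loop-closed F)) , (suffix F , suffix-level F)) ⟩
    Factorisation i k
      ∎
    where
    open EquationalReasoning
    open Factorisation using (prefix; prefix-level; loop; loop-closed; suffix; suffix-level)

  isM-factorises-uniquely : ∀ x → x when isM w ≡ ∑[ k < suc n ] ∑[ i < suc k ] (x when factorsAt w i k)
  isM-factorises-uniquely x = when-≡-∑<∑< n (factorsAt w) (isM w) x sound complete unique
    where
    open Equivalence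
    sound : ∀ i k → i ≤ k → k ≤ n → T (factorsAt w i k) → T (isM w)
    sound i k i≤k k≤n = from isM⇔IsMotzkin ∘ factorisation⇒motzkin ∘ to (factorsAt⇔Factorisation i≤k k≤n)
    complete : T (isM w) → ∃[ i ] ∃[ k ] i ≤ k × k ≤ n × T (factorsAt w i k)
    complete m with motzkin⇒factorisation (to isM⇔IsMotzkin m)
    ... | i , k , F = i , k , i≤k , k≤n , from (factorsAt⇔Factorisation i≤k k≤n) F
      where open Factorisation F
    unique : ∀ {i k i′ k′} → i ≤ k → k ≤ n → i′ ≤ k′ → k′ ≤ n →
             T (factorsAt w i k) → T (factorsAt w i′ k′) → i ≡ i′ × k ≡ k′
    unique i≤k k≤n i′≤k′ k′≤n f f′ = factorisation-unique (to (factorsAt⇔Factorisation i≤k k≤n) f)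
                                                          (to (factorsAt⇔Factorisation i′≤k′ k′≤n) f′)

splitsAt : (List Step → Bool) → List Step → ℕ → Bool
splitsAt c w k = (c (take k w) ∧ endsOnAxis (take k w)) ∧ isQ (drop k w)

module _ (c : List Step → Bool) (G : Point → Point → Set)
         (c-from : ∀ b x → T (c x) ⇔ All (G b) (visits b x))
         (G⇒notBelow : ∀ {b q} → G b q → NotBelow b q)
         (above⇒G : ∀ {b q} → Above b q → G b q) where

  module _ (w : List Step) where

    open Positions w
    open LastAxisVisit (position w) (length w) (G origin) G⇒notBelow above⇒G

    private
      n = length w
      P = position w

    c⇔Everywhere : T (c w) ⇔ (∀ s → 0 < s → s ≤ n → G origin (P s))
    c⇔Everywhere = ⇔.trans (≡⇒⇔ (cong (T ∘ c) (drop≡segment 0))) (class-segment c-from z≤n ℕP.≤-refl)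

    splitsAt⇔Split : ∀ {k} → k ≤ n → T (splitsAt c w k) ⇔ Split k
    splitsAt⇔Split {k} k≤n = begin
      T (splitsAt c w k)
        ≡⟨ cong (λ z → T ((c (take k w) ∧ endsOnAxis (take k w)) ∧ isQ z)) (drop≡segment k) ⟩
      T ((c (segment 0 k w) ∧ endsOnAxis (segment 0 k w)) ∧ isQ (segment k n w))
        ∼⟨ ⇔.trans T-∧ (T-∧ ×-⇔ ⇔.refl) ⟩
      ((T (c (segment 0 k w)) × T (endsOnAxis (segment 0 k w))) × T (isQ (segment k n w)))
        ∼⟨ (class-segment c-from z≤n k≤n ×-⇔ endsOnAxis-segment {j = k} z≤n)
          ×-⇔ class-segment isQ-from k≤n ℕP.≤-refl ⟩
      (((∀ s → 0 < s → s ≤ k → G origin (P s)) × OnLevel origin (P k))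
       × (∀ s → k < s → s ≤ n → Above (P k) (P s)))
        ∼⟨ mk⇔ (λ ((a , b) , e) → record { k≤n = k≤n ; prefix = a ; k-on-axis = b ; excursion = e })
               (λ L → (prefix L , k-on-axis L) , excursion L) ⟩
      Split k
        ∎
      where
      open EquationalReasoning
      open Split using (prefix; k-on-axis; excursion)

    splits-uniquely-at-last-axis-visit : ∀ x → x when c w ≡ ∑[ k < suc n ] (x when splitsAt c w k)
    splits-uniquely-at-last-axis-visit x = when-≡-∑< n (splitsAt c w) (c w) x sound complete unique
      where
      open Equivalence
      sound : ∀ k → k ≤ n → T (splitsAt c w k) → T (c w)
      sound k k≤n = from c⇔Everywhere ∘ split⇒all ∘ to (splitsAt⇔Split k≤n)
      complete : T (c w) → ∃[ k ] k ≤ n × T (splitsAt c w k)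
      complete cw with all⇒split (to c⇔Everywhere cw)
      ... | k , L = k , Split.k≤n L , from (splitsAt⇔Split (Split.k≤n L)) L
      unique : ∀ {k k′} → k ≤ n → k′ ≤ n → T (splitsAt c w k) → T (splitsAt c w k′) → k ≡ k′
      unique k≤n k′≤n s s′ = split-unique (to (splitsAt⇔Split k≤n) s) (to (splitsAt⇔Split k′≤n) s′)

  gf-split-at-last-axis-visit : gf c ≋ gf (λ a → c a ∧ endsOnAxis a) ⊛ gf isQ
  gf-split-at-last-axis-visit =
    gf-factorisation₂ c (λ a → c a ∧ endsOnAxis a) isQ splits-uniquely-at-last-axis-visit

reflect : Point → Point
reflect (x , y) = (- x , y)

endpoint-reverseWalk : ∀ u → endpoint (reverseWalk u) ≡ origin ⊖ endpoint u
endpoint-reverseWalk u = trans (endpoint-relative (endpoint u) (reverseWalk u))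
                               (cong (_⊖ endpoint u) (endFrom-reverseWalk origin u))

reflect-reverseWalk : ∀ u → proj₂ (endpoint (reverseWalk u)) ≡ + 0 →
                      reflect (endpoint (reverseWalk u)) ≡ endpoint u
reflect-reverseWalk u y≡0 rewrite endpoint-reverseWalk u with endpoint u
... | x , y = cong₂ _,_ (trans (cong -_ (ℤP.+-identityˡ (- x))) (ℤP.neg-involutive x))
                        (trans y≡0 (ℤP.i-j≡0⇒i≡j (+ 0) y y≡0))

xbar-S0 : xbar S0-gf ≋ gf (isS0 ∘ reverseWalk)
xbar-S0 .∑-≡ n h = begin
  ∑ (xbar S0-gf n) h
    ≡⟨ ∑-map reflect (S0-gf n) h ⟩
  ∑[ p ∈ S0-gf n ] h (reflect p)
    ≡⟨ ∑-gf isS0 n (h ∘ reflect) ⟩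
  ∑[ w ∈ words n ] (h (reflect (endpoint w)) when isS0 w)
    ≡⟨ ∑-words-reverseWalk n _ ⟩
  ∑[ u ∈ words n ] (h (reflect (endpoint (reverseWalk u))) when isS0 (reverseWalk u))
    ≡⟨ ∑-cong (words n) (λ u → when-cong (isS0 (reverseWalk u))
                                          (cong h ∘ reflect-reverseWalk u ∘ endsOnAxis⇒ u)) ⟩
  ∑[ u ∈ words n ] (h (endpoint u) when isS0 (reverseWalk u))
    ≡⟨ ∑-gf (isS0 ∘ reverseWalk) n h ⟨
  ∑ (gf (isS0 ∘ reverseWalk) n) h
    ∎
  where
  open ≡-Reasoning
  endsOnAxis⇒ : ∀ u → T (isS0 (reverseWalk u)) → proj₂ (endpoint (reverseWalk u)) ≡ + 0
  endsOnAxis⇒ u = Equivalence.to (T-does (_ ℤP.≟ + 0)) ∘ proj₂ ∘ Equivalence.to T-∧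

M-factorisation : M-gf ≋ (gf (isS0 ∘ reverseWalk) ⊛ L-gf) ⊛ S0-gf
M-factorisation = gf-factorisation₃ isM (isS0 ∘ reverseWalk) isL isS0 isM-factorises-uniquely

S-factorisation : S-gf ≋ S0-gf ⊛ gf isQ
S-factorisation = gf-split-at-last-axis-visit isS S-admissible isS-from proj₁
  (λ b<q → ℤP.<⇒≤ b<q , λ q∈level → ⊥-elim (ℤP.<-irrefl (sym q∈level) b<q))

upper-factorisation : gf upper ≋ M-gf ⊛ gf isQ
upper-factorisation = gf-split-at-last-axis-visit upper NotBelow upper-from (λ q → q) ℤP.<⇒≤

-- The series 1/(1 - tyM)

infixl 6 _⊕_

_⊕_ : Series → Series → Series
(A ⊕ B) n = A n ++ B n

north : Point
north = (+ 0 , + 1)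

∑-tyM⊛ : ∀ A m (h : Point → ℕ) → ∑ ((tyM ⊛ A) (suc m)) h ≡ ∑ ((M-gf ⊛ A) m) (h ∘ addP north)
∑-tyM⊛ A m h = begin
  ∑ ((tyM ⊛ A) (suc m)) h
    ≡⟨ ∑-⊛ tyM A (suc m) h ⟩
  ∑[ j < suc (suc m) ] ∑[ a ∈ tyM j ] ∑[ b ∈ A (suc m ∸ j) ] h (addP a b)
    ≡⟨ ∑<-suc (suc m) _ ⟩
  ∑[ j < suc m ] ∑[ a ∈ map (addP north) (M-gf j) ] ∑[ b ∈ A (m ∸ j) ] h (addP a b)
    ≡⟨ ∑<-cong (suc m) (λ j _ → trans (∑-map (addP north) (M-gf j) _) (∑-cong (M-gf j) λ c →
         ∑-cong (A (m ∸ j)) λ b → cong h (addP-assoc north c b))) ⟩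
  ∑[ j < suc m ] ∑[ c ∈ M-gf j ] ∑[ b ∈ A (m ∸ j) ] h (addP north (addP c b))
    ≡⟨ ∑-⊛ M-gf A m (h ∘ addP north) ⟨
  ∑ ((M-gf ⊛ A) m) (h ∘ addP north)
    ∎
  where open ≡-Reasoning

tyM⊛-cong-< : ∀ {A B} n → (∀ r → r < n → ∀ h → ∑ (A r) h ≡ ∑ (B r) h) →
              ∀ h → ∑ ((tyM ⊛ A) n) h ≡ ∑ ((tyM ⊛ B) n) h
tyM⊛-cong-< zero    A≋B h = refl
tyM⊛-cong-< {A} {B} (suc m) A≋B h = begin
  ∑ ((tyM ⊛ A) (suc m)) h             ≡⟨ ∑-tyM⊛ A m h ⟩
  ∑ ((M-gf ⊛ A) m) (h ∘ addP north)   ≡⟨ ⊛-cong-≤ M-gf {A} {B} m (λ r r≤m → A≋B r (s≤s r≤m)) _ ⟩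
  ∑ ((M-gf ⊛ B) m) (h ∘ addP north)   ≡⟨ ∑-tyM⊛ B m h ⟨
  ∑ ((tyM ⊛ B) (suc m)) h             ∎
  where open ≡-Reasoning

recurrence-unique : ∀ {A B} → A ≋ one ⊕ tyM ⊛ A → B ≋ one ⊕ tyM ⊛ B → A ≋ B
recurrence-unique {A} {B} A≋ B≋ .∑-≡ n = agree-below (suc n) n ℕP.≤-refl
  where
  open ≡-Reasoning
  agree-below : ∀ m r → r < m → ∀ h → ∑ (A r) h ≡ ∑ (B r) h
  agree-below (suc m) r r<1+m h = begin
    ∑ (A r) h                           ≡⟨ A≋ .∑-≡ r h ⟩
    ∑ (one r ++ (tyM ⊛ A) r) h          ≡⟨ ∑-++ (one r) _ h ⟩
    ∑ (one r) h + ∑ ((tyM ⊛ A) r) h     ≡⟨ cong (_+_ (∑ (one r) h)) (tyM⊛-cong-< {A} {B} r below h) ⟩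
    ∑ (one r) h + ∑ ((tyM ⊛ B) r) h     ≡⟨ ∑-++ (one r) _ h ⟨
    ∑ (one r ++ (tyM ⊛ B) r) h          ≡⟨ B≋ .∑-≡ r h ⟨
    ∑ (B r) h                           ∎
    where below = λ r′ r′<r → agree-below m r′ (ℕP.<-≤-trans r′<r (ℕP.≤-pred r<1+m))

isQ-north : ∀ r → isQ (N ∷ r) ≡ upper r
isQ-north r = T-injective (begin
  T (isQ (N ∷ r))                            ∼⟨ isQ-from origin (N ∷ r) ⟩
  All (Above origin) (north ∷ visits north r) ∼⟨ mk⇔ (λ { (_ ∷ as) → as }) (ℤ.+<+ (s≤s z≤n) ∷_) ⟩
  All (Above origin) (visits north r)        ∼⟨ All-⇔ (λ q → mk⇔ ℤP.i<j⇒suc[i]≤j ℤP.suc[i]≤j⇒i<j) _ ⟩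
  All (NotBelow north) (visits north r)      ∼⟨ ⇔.sym (upper-from north r) ⟩
  T (upper r)                                ∎)
  where open EquationalReasoning

∑-steps-north : ∀ (G : Step → ℕ) → G E ≡ 0 → G W ≡ 0 → G S ≡ 0 → ∑ steps G ≡ G N
∑-steps-north G GE≡0 GW≡0 GS≡0 rewrite GE≡0 | GW≡0 | GS≡0 = ℕP.+-identityʳ (G N)

Q-recurrence : gf isQ ≋ one ⊕ tyM ⊛ gf isQ
Q-recurrence .∑-≡ zero    h = refl
Q-recurrence .∑-≡ (suc m) h = begin
  ∑ (gf isQ (suc m)) h
    ≡⟨ ∑-gf isQ (suc m) h ⟩
  ∑[ q ∈ words (suc m) ] (h (endpoint q) when isQ q)
    ≡⟨ ∑-words-suc m _ ⟩
  ∑[ s ∈ steps ] ∑[ r ∈ words m ] (h (endpoint (s ∷ r)) when isQ (s ∷ r))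
    -- a first step E, W or S already leaves the open upper half-plane
    ≡⟨ ∑-steps-north F (∑-zero (words m) (λ _ → refl)) (∑-zero (words m) (λ _ → refl))
                       (∑-zero (words m) (λ _ → refl)) ⟩
  ∑[ r ∈ words m ] (h (endpoint (N ∷ r)) when isQ (N ∷ r))
    ≡⟨ ∑-cong (words m) (λ r → cong₂ (λ e b → h e when b) (endpoint-++ [ N ] r) (isQ-north r)) ⟩
  ∑[ r ∈ words m ] (h (addP north (endpoint r)) when upper r)
    ≡⟨ ∑-gf upper m (h ∘ addP north) ⟨
  ∑ (gf upper m) (h ∘ addP north)
    ≡⟨ upper-factorisation .∑-≡ m (h ∘ addP north) ⟩
  ∑ ((M-gf ⊛ gf isQ) m) (h ∘ addP north)
    ≡⟨ ∑-tyM⊛ (gf isQ) m h ⟨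
  ∑ ((tyM ⊛ gf isQ) (suc m)) h
    ∎
  where
  open ≡-Reasoning
  F : Step → ℕ
  F s = ∑[ r ∈ words m ] (h (endpoint (s ∷ r)) when isQ (s ∷ r))

∑-invOneMinusTyM : ∀ m (h : Point → ℕ) → ∑ (invOneMinusTyM m) h ≡ ∑[ k < suc m ] ∑ (powTyM k m) h
∑-invOneMinusTyM m h = trans (∑-concatMap (λ k → powTyM k m) (upTo (suc m)) h) (∑-upTo (suc m) _)

∑-powTyM-vanishes : ∀ k m → m < k → ∀ h → ∑ (powTyM k m) h ≡ 0
∑-powTyM-vanishes (suc k) zero    _         h = refl
∑-powTyM-vanishes (suc k) (suc m) (s≤s m<k) h = begin
  ∑ ((tyM ⊛ powTyM k) (suc m)) h
    ≡⟨ ∑-tyM⊛ (powTyM k) m h ⟩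
  ∑ ((M-gf ⊛ powTyM k) m) (h ∘ addP north)
    ≡⟨ ∑-⊛ M-gf (powTyM k) m _ ⟩
  ∑[ j < suc m ] ∑[ c ∈ M-gf j ] ∑[ b ∈ powTyM k (m ∸ j) ] h (addP north (addP c b))
    ≡⟨ ∑<-zero (suc m) (λ j _ → ∑-zero (M-gf j) λ c →
         ∑-powTyM-vanishes k (m ∸ j) (ℕP.≤-<-trans (ℕP.m∸n≤m m j) m<k) _) ⟩
  0 ∎
  where open ≡-Reasoning

invOneMinusTyM-recurrence : invOneMinusTyM ≋ one ⊕ tyM ⊛ invOneMinusTyM
invOneMinusTyM-recurrence .∑-≡ zero    h = refl
invOneMinusTyM-recurrence .∑-≡ (suc m) h = begin
  ∑ (invOneMinusTyM (suc m)) h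
    ≡⟨ ∑-invOneMinusTyM (suc m) h ⟩
  ∑[ k < suc (suc m) ] ∑ (powTyM k (suc m)) h
    ≡⟨ ∑<-suc (suc m) _ ⟩
  ∑[ k < suc m ] ∑ ((tyM ⊛ powTyM k) (suc m)) h
    ≡⟨ ∑<-cong (suc m) (λ k _ → trans (∑-tyM⊛ (powTyM k) m h) (∑-⊛ M-gf (powTyM k) m _)) ⟩
  ∑[ k < suc m ] ∑[ j < suc m ] ∑[ c ∈ M-gf j ] ∑[ b ∈ powTyM k (m ∸ j) ] h′ (addP c b)
    ≡⟨ ∑<-swap (suc m) (suc m) _ ⟩
  ∑[ j < suc m ] ∑[ k < suc m ] ∑[ c ∈ M-gf j ] ∑[ b ∈ powTyM k (m ∸ j) ] h′ (addP c b)
    ≡⟨ ∑<-cong (suc m) (λ j _ → trans (∑<-∑ (suc m) (M-gf j) _) (∑-cong (M-gf j) λ c → truncate j c)) ⟩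
  ∑[ j < suc m ] ∑[ c ∈ M-gf j ] ∑[ b ∈ invOneMinusTyM (m ∸ j) ] h′ (addP c b)
    ≡⟨ ∑-⊛ M-gf invOneMinusTyM m h′ ⟨
  ∑ ((M-gf ⊛ invOneMinusTyM) m) h′
    ≡⟨ ∑-tyM⊛ invOneMinusTyM m h ⟨
  ∑ ((tyM ⊛ invOneMinusTyM) (suc m)) h
    ∎
  where
  open ≡-Reasoning
  h′ = h ∘ addP north
  truncate : ∀ j c → ∑[ k < suc m ] ∑[ b ∈ powTyM k (m ∸ j) ] h′ (addP c b)
                   ≡ ∑[ b ∈ invOneMinusTyM (m ∸ j) ] h′ (addP c b)
  truncate j c = trans
    (∑<-truncate (suc m) _ (s≤s (ℕP.m∸n≤m m j)) (λ k m∸j<k _ → ∑-powTyM-vanishes k (m ∸ j) m∸j<k _))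
    (sym (∑-invOneMinusTyM (m ∸ j) _))

Q≋invOneMinusTyM : gf isQ ≋ invOneMinusTyM
Q≋invOneMinusTyM = recurrence-unique Q-recurrence invOneMinusTyM-recurrence

xbarS0⊛L⊛S0≋M : (xbar S0-gf ⊛ L-gf) ⊛ S0-gf ≋ M-gf
xbarS0⊛L⊛S0≋M =
  ≋-trans (⊛-cong (⊛-cong xbar-S0 (≋-refl {L-gf})) (≋-refl {S0-gf})) (≋-sym M-factorisation)

S≋S0⊛invOneMinusTyM : S-gf ≋ S0-gf ⊛ invOneMinusTyM
S≋S0⊛invOneMinusTyM = ≋-trans S-factorisation (⊛-cong (≋-refl {S0-gf}) Q≋invOneMinusTyM)

proposition8p3 : ((xbar S0-gf ⊛ L-gf) ⊛ S0-gf) ≈ M-gf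
    × S-gf ≈ (S0-gf ⊛ invOneMinusTyM)
proposition8p3 = ≋⇒≈ xbarS0⊛L⊛S0≋M , ≋⇒≈ S≋S0⊛invOneMinusTyM
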